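{- Let $\mathcal{P}_1$ (resp. $\mathcal{P}_2$) be the set of partitions whose even-indexed (resp. odd-indexed) parts are all even. Then, as formal power series in $q$, $$\sum_{\lambda\in\mathcal{P}_{1}}x^{o(\lambda)}z^{a(\lambda)}q^{|\lambda|}=\sum_{n=0}^{\infty}\frac{q^{4n}(-xzq^{ -3};q^4)_{n}}{(z^2q^2;q^4)_{n}(q^4;q^4)_{n}}+\sum_{n=0}^{\infty}\frac{z^{2}q^{4n+2}(-xzq;q^4)_{n}}{(z^2q^2;q^4)_{n+1}(q^4;q^4)_{n}}=\frac{(-xzq;q^4)_{\infty}}{(z^2q^2;q^4)_{\infty}(q^4;q^4)_{\infty}},$$ $$\sum_{\lambda\in\mathcal{P}_{2}}x^{o(\lambda)}z^{a(\lambda)}q^{|\lambda|}=\sum_{n=0}^{\infty}\frac{q^{4n}(-xz/q;q^4)_{n}}{(z^2q^2;q^4)_{n}(q^4;q^4)_{n}}+\sum_{n=0}^{\infty}\frac{z^2q^{4n+2}(-xzq^3;q^4)_{n}}{(z^2q^2;q^4)_{n+1}(q^4;q^4)_{n}}=\frac{(-xzq^3;q^4)_{\infty}}{(z^2q^2;q^4)_{\infty}(q^4;q^4)_{\infty}}.$$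
   Context: A partition is a finite weakly decreasing sequence $\lambda=(\lambda_1,\ldots,\lambda_\ell)$ of positive integers (empty partition included). $|\lambda|=\sum_i\lambda_i$, $o(\lambda)$ is the number of odd parts, and $a(\lambda)=\lambda_1-\lambda_2+\lambda_3-\cdots+(-1)^{\ell-1}\lambda_\ell$ is the alternating sum. $(x;q)_0=1$, $(x;q)_n=\prod_{i=0}^{n-1}(1-xq^i)$, $(x;q)_\infty=\prod_{i\ge0}(1-xq^i)$. -}

module Defs where

open import Data.Nat using (ℕ; zero; suc; _∸_; _%_; _≟_) renaming (_+_ to _+ℕ_; _*_ to _*ℕ_)
open import Data.Nat.Divisibility using (_∣_)
open import Data.Integer using (ℤ; +_; -_; _+_; _*_; _-_; 0ℤ; 1ℤ)
open import Data.List using (List; []; _∷_; length)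
open import Data.List.Relation.Unary.All using (All)
open import Data.List.Relation.Unary.Unique.Propositional using (Unique)
open import Data.List.Membership.Propositional using (_∈_)
open import Data.Nat using (_≤_; _<_)
open import Data.Unit using (⊤)
open import Data.Product using (_×_; ∃)
open import Function.Bundles using (_⇔_)
open import Relation.Binary.PropositionalEquality using (_≡_)
open import Relation.Nullary.Decidable using (⌊_⌋)
open import Data.Bool using (if_then_else_)

data Decreasing : List ℕ → Set where
  []  : Decreasing []
  [_] : ∀ x → Decreasing (x ∷ [])
  _∷_ : ∀ {x y r} → y ≤ x → Decreasing (y ∷ r) → Decreasing (x ∷ y ∷ r)

IsPartition : List ℕ → Set
IsPartition λs = All (λ p → 0 < p) λs × Decreasing λs

size : List ℕ → ℕ
size []       = 0
size (p ∷ ps) = p +ℕ size ps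

oddParts : List ℕ → ℕ
oddParts []       = 0
oddParts (p ∷ ps) = (p % 2) +ℕ oddParts ps

altSum : List ℕ → ℤ
altSum []       = 0ℤ
altSum (p ∷ ps) = + p - altSum ps

EvenIndexedEven : List ℕ → Set
EvenIndexedEven []            = ⊤
EvenIndexedEven (_ ∷ [])      = ⊤
EvenIndexedEven (_ ∷ y ∷ r)   = (2 ∣ y) × EvenIndexedEven r

OddIndexedEven : List ℕ → Set
OddIndexedEven []       = ⊤
OddIndexedEven (x ∷ r)  = (2 ∣ x) × EvenIndexedEven r

InP1 : List ℕ → Set
InP1 λs = IsPartition λs × EvenIndexedEven λs

InP2 : List ℕ → Set
InP2 λs = IsPartition λs × OddIndexedEven λs

-- Formal power series ℤ[[x,z,q]]:  f i j N = coefficient of x^i z^j q^N.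
-- (All series of the theorem lie in ℤ[x,z][[q]] ⊆ ℤ[[x,z,q]].)

FPS : Set
FPS = ℕ → ℕ → ℕ → ℤ

sumTo : ℕ → (ℕ → ℤ) → ℤ
sumTo zero    f = 0ℤ
sumTo (suc n) f = sumTo n f + f n

one : FPS
one i j N = if ⌊ i ≟ 0 ⌋ then (if ⌊ j ≟ 0 ⌋ then (if ⌊ N ≟ 0 ⌋ then 1ℤ else 0ℤ) else 0ℤ) else 0ℤ

mono : ℤ → ℕ → ℕ → ℕ → FPS
mono c a b d i j N =
  if ⌊ i ≟ a ⌋ then (if ⌊ j ≟ b ⌋ then (if ⌊ N ≟ d ⌋ then c else 0ℤ) else 0ℤ) else 0ℤ

infixl 6 _⊕_ _⊖_
infixl 7 _⊗_

_⊕_ : FPS → FPS → FPS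
(f ⊕ g) i j N = f i j N + g i j N

_⊖_ : FPS → FPS → FPS
(f ⊖ g) i j N = f i j N - g i j N

_⊗_ : FPS → FPS → FPS
(f ⊗ g) i j N =
  sumTo (suc i) λ a → sumTo (suc j) λ b → sumTo (suc N) λ c →
    f a b c * g (i ∸ a) (j ∸ b) (N ∸ c)

pow : FPS → ℕ → FPS
pow f zero    = one
pow f (suc k) = pow f k ⊗ f

prodFin : (ℕ → FPS) → ℕ → FPS
prodFin f zero    = one
prodFin f (suc n) = prodFin f n ⊗ f n

-- infinite sum Σ_{n ≥ 0} f n, for families where f n has q-order ≥ n
-- (so the coefficient of q^N only involves n ≤ N)
sumInf : (ℕ → FPS) → FPS
sumInf f i j N = sumTo (suc N) λ n → f n i j N

-- infinite product ∏_{k ≥ 0} f k, for families where f k - 1 has q-order ≥ k+1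
prodInf : (ℕ → FPS) → FPS
prodInf f i j N = prodFin f (suc N) i j N

-- 1/(1 - m) = Σ_k m^k, for m of positive q-order
inv1m : FPS → FPS
inv1m m = sumInf (pow m)

-- q-Pochhammer symbols with base q^4 for a monomial m = c x^a z^b q^d (d ≥ 1):
--   (m;q^4)_n = ∏_{k<n} (1 - c x^a z^b q^{d+4k})

poch4 : ℤ → ℕ → ℕ → ℕ → ℕ → FPS
poch4 c a b d n = prodFin (λ k → one ⊖ mono c a b (d +ℕ 4 *ℕ k)) n

invPoch4 : ℤ → ℕ → ℕ → ℕ → ℕ → FPS
invPoch4 c a b d n = prodFin (λ k → inv1m (mono c a b (d +ℕ 4 *ℕ k))) n

poch4∞ : ℤ → ℕ → ℕ → ℕ → FPS
poch4∞ c a b d = prodInf (λ k → one ⊖ mono c a b (d +ℕ 4 *ℕ k))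

invPoch4∞ : ℤ → ℕ → ℕ → ℕ → FPS
invPoch4∞ c a b d = prodInf (λ k → inv1m (mono c a b (d +ℕ 4 *ℕ k)))

-- q^{4n} (-x z q^{-e}; q^4)_n  for e ≤ 4, written without negative powers:
--   = ∏_{k<n} q^4 (1 + x z q^{4k-e}) = ∏_{k<n} (q^4 + x z q^{4k+4-e})
shiftedPoch4 : ℕ → ℕ → FPS
shiftedPoch4 e n = prodFin (λ k → mono 1ℤ 0 0 4 ⊕ mono 1ℤ 1 1 (4 *ℕ k +ℕ 4 ∸ e)) n

HasCoeff : (List ℕ → Set) → ℕ → ℕ → ℕ → ℤ → Set
HasCoeff P i j N c =
  ∃ λ (L : List (List ℕ)) →
    Unique L ×
    (∀ λs → (λs ∈ L) ⇔ (P λs × oddParts λs ≡ i × altSum λs ≡ + j × size λs ≡ N)) ×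
    + length L ≡ c

IsGenFun : (List ℕ → Set) → FPS → Set
IsGenFun P f = ∀ i j N → HasCoeff P i j N (f i j N)

sumSide1 : FPS
sumSide1 =
  sumInf (λ n → shiftedPoch4 3 n ⊗ invPoch4 1ℤ 0 2 2 n ⊗ invPoch4 1ℤ 0 0 4 n)
  ⊕ sumInf (λ n → mono 1ℤ 0 2 (4 *ℕ n +ℕ 2) ⊗ poch4 (- 1ℤ) 1 1 1 n
                   ⊗ invPoch4 1ℤ 0 2 2 (suc n) ⊗ invPoch4 1ℤ 0 0 4 n)

prodSide1 : FPS
prodSide1 = poch4∞ (- 1ℤ) 1 1 1 ⊗ invPoch4∞ 1ℤ 0 2 2 ⊗ invPoch4∞ 1ℤ 0 0 4

sumSide2 : FPS
sumSide2 =
  sumInf (λ n → shiftedPoch4 1 n ⊗ invPoch4 1ℤ 0 2 2 n ⊗ invPoch4 1ℤ 0 0 4 n)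
  ⊕ sumInf (λ n → mono 1ℤ 0 2 (4 *ℕ n +ℕ 2) ⊗ poch4 (- 1ℤ) 1 1 3 n
                   ⊗ invPoch4 1ℤ 0 2 2 (suc n) ⊗ invPoch4 1ℤ 0 0 4 n)

prodSide2 : FPS
prodSide2 = poch4∞ (- 1ℤ) 1 1 3 ⊗ invPoch4∞ 1ℤ 0 2 2 ⊗ invPoch4∞ 1ℤ 0 0 4

-- All series live in ℤ[[x,z,q]], built as power series over power series over power series, and
-- both identities are proved coefficientwise; d = 1 for P₁ and d = 3 for P₂.
--
-- Sum side = product side: since 1/(1 - m) = 1 + m/(1 - m), the partial sums telescope,
--   Σ_{n ≤ M} (n-th terms of both sums) = (-xzq^d;q⁴)_M / ((z²q²;q⁴)_{M+1} (q⁴;q⁴)_M),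
-- and up to degree N these truncated products agree with the infinite ones.
--
-- Generating function: pad a partition of size N with zeros to length 2N. A padded list of
-- length 2k+2 in the class corresponds bijectively to a padded list of length 2k together with
-- a triple (ε, s, r) ∈ {0,1} × ℕ × ℕ coding its last two parts: the first 2k parts are lowered by
-- the even number 2(s + r + ε), which keeps the parity conditions and the alternating sum, and
-- the triple contributes x^ε z^(ε+2s) q^(ε(d+4k) + s(2+4k) + r(4+4k)). So padded lists of length
-- 2K have generating function ∏_{k<K} (1 + xzq^(d+4k)) / ((1 - z²q^(2+4k)) (1 - q^(4+4k))).

module Submission where

open import Level using (0ℓ)
open import Algebra.Bundles using (CommutativeSemiring)
open import Algebra.Core using (Op₂)
open import Algebra.Structures using (IsCommutativeSemiring)
open import Relation.Binary.Core using (Rel)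
open import Data.Nat using (ℕ; zero; suc; _∸_; _≤_; _<_; z≤n; s≤s; >-nonZero)
  renaming (_+_ to _+ℕ_; _*_ to _*ℕ_)
open import Data.Nat.Properties as ℕ using (≤-refl; ≤-pred; m<n⇒m<1+n)
open import Data.Product as Product using (_×_; _,_; proj₁; proj₂)
open import Data.Sum using (_⊎_; inj₁; inj₂) renaming ([_,_] to either)
open import Data.Sum.Properties using (inj₁-injective; inj₂-injective)
open import Data.Bool using (true; false)
open import Function using (_∘_)
open import Relation.Binary.PropositionalEquality as ≡ using (_≡_; _≢_; ≢-sym)
open import Defs

module PowerSeries {c ℓ} (R : CommutativeSemiring c ℓ) where

  open CommutativeSemiring R
  open import Relation.Binary.Reasoning.Setoid setoid
  import Algebra.Construct.Pointwise ℕ as Pointwise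

  ∑< : ℕ → (ℕ → Carrier) → Carrier
  ∑< zero    f = 0#
  ∑< (suc n) f = ∑< n f + f n

  ∑<-cong< : ∀ n {f g} → (∀ k → k < n → f k ≈ g k) → ∑< n f ≈ ∑< n g
  ∑<-cong< zero    f≈g = refl
  ∑<-cong< (suc n) f≈g = +-cong (∑<-cong< n (λ k k<n → f≈g k (m<n⇒m<1+n k<n))) (f≈g n ≤-refl)

  ∑<-cong : ∀ n {f g} → (∀ k → f k ≈ g k) → ∑< n f ≈ ∑< n g
  ∑<-cong n f≈g = ∑<-cong< n (λ k _ → f≈g k)

  ∑<-zero : ∀ n → ∑< n (λ _ → 0#) ≈ 0#
  ∑<-zero zero    = refl
  ∑<-zero (suc n) = trans (+-identityʳ _) (∑<-zero n)

  ∑<-suc : ∀ n f → ∑< (suc n) f ≈ f 0 + ∑< n (f ∘ suc)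
  ∑<-suc zero    f = trans (+-identityˡ _) (sym (+-identityʳ _))
  ∑<-suc (suc n) f = begin
    ∑< (suc n) f + f (suc n)              ≈⟨ +-congʳ (∑<-suc n f) ⟩
    f 0 + ∑< n (f ∘ suc) + f (suc n)      ≈⟨ +-assoc _ _ _ ⟩
    f 0 + (∑< n (f ∘ suc) + f (suc n))    ∎

  ∑<-distrib-+ : ∀ n f g → ∑< n (λ k → f k + g k) ≈ ∑< n f + ∑< n g
  ∑<-distrib-+ zero    f g = sym (+-identityˡ _)
  ∑<-distrib-+ (suc n) f g = begin
    ∑< n (λ k → f k + g k) + (f n + g n)  ≈⟨ +-congʳ (∑<-distrib-+ n f g) ⟩
    ∑< n f + ∑< n g + (f n + g n)         ≈⟨ +-assoc _ _ _ ⟩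
    ∑< n f + (∑< n g + (f n + g n))       ≈⟨ +-congˡ (x+[y+z]≈y+[x+z] _ _ _) ⟩
    ∑< n f + (f n + (∑< n g + g n))       ≈⟨ +-assoc _ _ _ ⟨
    ∑< n f + f n + (∑< n g + g n)         ∎
    where
    x+[y+z]≈y+[x+z] : ∀ x y z → x + (y + z) ≈ y + (x + z)
    x+[y+z]≈y+[x+z] x y z = trans (sym (+-assoc x y z)) (trans (+-congʳ (+-comm x y)) (+-assoc y x z))

  *-distribˡ-∑< : ∀ n a f → a * ∑< n f ≈ ∑< n (λ k → a * f k)
  *-distribˡ-∑< zero    a f = zeroʳ a
  *-distribˡ-∑< (suc n) a f = trans (distribˡ a _ _) (+-congʳ (*-distribˡ-∑< n a f))

  ∑<-reverse : ∀ n f → ∑< n f ≈ ∑< n (λ k → f (n ∸ suc k))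
  ∑<-reverse zero    f = refl
  ∑<-reverse (suc n) f = begin
    ∑< n f + f n                          ≈⟨ +-congʳ (∑<-reverse n f) ⟩
    ∑< n (λ k → f (n ∸ suc k)) + f n      ≈⟨ +-comm _ _ ⟩
    f n + ∑< n (λ k → f (n ∸ suc k))      ≈⟨ ∑<-suc n (λ k → f (n ∸ k)) ⟨
    ∑< (suc n) (λ k → f (n ∸ k))          ∎

  Series : Set c
  Series = ℕ → Carrier

  infix  4 _≈ₛ_
  infixl 7 _*ₛ_

  _≈ₛ_ : Series → Series → Set ℓ
  f ≈ₛ g = ∀ n → f n ≈ g n

  _*ₛ_ : Series → Series → Series
  (f *ₛ g) n = ∑< (suc n) (λ k → f k * g (n ∸ k))

  1ₛ : Series
  1ₛ zero    = 1#
  1ₛ (suc n) = 0#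

  *ₛ-cong : ∀ {f f′ g g′} → f ≈ₛ f′ → g ≈ₛ g′ → f *ₛ g ≈ₛ f′ *ₛ g′
  *ₛ-cong f≈f′ g≈g′ n = ∑<-cong (suc n) (λ k → *-cong (f≈f′ k) (g≈g′ (n ∸ k)))

  *ₛ-comm : ∀ f g → f *ₛ g ≈ₛ g *ₛ f
  *ₛ-comm f g n = begin
    ∑< (suc n) (λ k → f k * g (n ∸ k))              ≈⟨ ∑<-reverse (suc n) _ ⟩
    ∑< (suc n) (λ k → f (n ∸ k) * g (n ∸ (n ∸ k)))  ≈⟨ ∑<-cong< (suc n) swap ⟩
    ∑< (suc n) (λ k → g k * f (n ∸ k))              ∎
    where
    swap : ∀ k → k < suc n → f (n ∸ k) * g (n ∸ (n ∸ k)) ≈ g k * f (n ∸ k)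
    swap k k<1+n rewrite ℕ.m∸[m∸n]≡n (≤-pred k<1+n) = *-comm _ _

  *ₛ-identityˡ : ∀ f → 1ₛ *ₛ f ≈ₛ f
  *ₛ-identityˡ f n = begin
    ∑< (suc n) (λ k → 1ₛ k * f (n ∸ k))             ≈⟨ ∑<-suc n _ ⟩
    1# * f n + ∑< n (λ k → 0# * f (n ∸ suc k))      ≈⟨ +-cong (*-identityˡ _) (∑<-cong n (λ k → zeroˡ _)) ⟩
    f n + ∑< n (λ _ → 0#)                           ≈⟨ +-congˡ (∑<-zero n) ⟩
    f n + 0#                                        ≈⟨ +-identityʳ _ ⟩
    f n                                             ∎

  *ₛ-zeroˡ : ∀ f → (λ _ → 0#) *ₛ f ≈ₛ (λ _ → 0#)
  *ₛ-zeroˡ f n = trans (∑<-cong (suc n) (λ k → zeroˡ _)) (∑<-zero (suc n))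

  *ₛ-distribˡ : ∀ f g h → f *ₛ (λ k → g k + h k) ≈ₛ (λ k → (f *ₛ g) k + (f *ₛ h) k)
  *ₛ-distribˡ f g h n = trans (∑<-cong (suc n) (λ k → distribˡ _ _ _)) (∑<-distrib-+ (suc n) _ _)

  private
    shift : Series → Series
    shift f = f ∘ suc

    *ₛ-suc : ∀ f g n → (f *ₛ g) (suc n) ≈ f 0 * g (suc n) + (shift f *ₛ g) n
    *ₛ-suc f g n = ∑<-suc (suc n) _

    scale+-*ₛ : ∀ a u v h n → ((λ k → a * u k + v k) *ₛ h) n ≈ a * (u *ₛ h) n + (v *ₛ h) n
    scale+-*ₛ a u v h n = begin
      ∑< (suc n) (λ k → (a * u k + v k) * h (n ∸ k))
        ≈⟨ ∑<-cong (suc n) (λ k → trans (distribʳ _ _ _) (+-congʳ (*-assoc _ _ _))) ⟩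
      ∑< (suc n) (λ k → a * (u k * h (n ∸ k)) + v k * h (n ∸ k))
        ≈⟨ ∑<-distrib-+ (suc n) _ _ ⟩
      ∑< (suc n) (λ k → a * (u k * h (n ∸ k))) + (v *ₛ h) n
        ≈⟨ +-congʳ (*-distribˡ-∑< (suc n) a _) ⟨
      a * (u *ₛ h) n + (v *ₛ h) n ∎

  *ₛ-assoc : ∀ f g h → (f *ₛ g) *ₛ h ≈ₛ f *ₛ (g *ₛ h)
  *ₛ-assoc f g h zero = begin
    0# + (0# + f 0 * g 0) * h 0     ≈⟨ +-congˡ (*-congʳ (+-identityˡ _)) ⟩
    0# + f 0 * g 0 * h 0            ≈⟨ +-congˡ (*-assoc _ _ _) ⟩
    0# + f 0 * (g 0 * h 0)          ≈⟨ +-congˡ (*-congˡ (+-identityˡ _)) ⟨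
    0# + f 0 * (0# + g 0 * h 0)     ∎
  *ₛ-assoc f g h (suc n) = begin
    ((f *ₛ g) *ₛ h) (suc n)
      ≈⟨ *ₛ-suc (f *ₛ g) h n ⟩
    (f *ₛ g) 0 * h (suc n) + (shift (f *ₛ g) *ₛ h) n
      ≈⟨ +-cong (*-congʳ (+-identityˡ _)) (*ₛ-cong {g = h} (*ₛ-suc f g) (λ _ → refl) n) ⟩
    f 0 * g 0 * h (suc n) + ((λ k → f 0 * shift g k + (shift f *ₛ g) k) *ₛ h) n
      ≈⟨ +-congˡ (scale+-*ₛ (f 0) (shift g) (shift f *ₛ g) h n) ⟩
    f 0 * g 0 * h (suc n) + (f 0 * (shift g *ₛ h) n + ((shift f *ₛ g) *ₛ h) n)
      ≈⟨ +-congˡ (+-congˡ (*ₛ-assoc (shift f) g h n)) ⟩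
    f 0 * g 0 * h (suc n) + (f 0 * (shift g *ₛ h) n + (shift f *ₛ (g *ₛ h)) n)
      ≈⟨ +-assoc _ _ _ ⟨
    f 0 * g 0 * h (suc n) + f 0 * (shift g *ₛ h) n + (shift f *ₛ (g *ₛ h)) n
      ≈⟨ +-congʳ (trans (+-congʳ (*-assoc _ _ _)) (sym (distribˡ _ _ _))) ⟩
    f 0 * (g 0 * h (suc n) + (shift g *ₛ h) n) + (shift f *ₛ (g *ₛ h)) n
      ≈⟨ +-congʳ (*-congˡ (*ₛ-suc g h n)) ⟨
    f 0 * (g *ₛ h) (suc n) + (shift f *ₛ (g *ₛ h)) n
      ≈⟨ *ₛ-suc f (g *ₛ h) n ⟨
    (f *ₛ (g *ₛ h)) (suc n) ∎

  commutativeSemiring : CommutativeSemiring c ℓ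
  commutativeSemiring = record
    { Carrier = Series
    ; _≈_ = _≈ₛ_
    ; _+_ = λ f g n → f n + g n
    ; _*_ = _*ₛ_
    ; 0# = λ _ → 0#
    ; 1# = 1ₛ
    ; isCommutativeSemiring = record
      { isSemiring = record
        { isSemiringWithoutAnnihilatingZero = record
          { +-isCommutativeMonoid = Pointwise.isCommutativeMonoid +-isCommutativeMonoid
          ; *-cong = *ₛ-cong
          ; *-assoc = *ₛ-assoc
          ; *-identity = *ₛ-identityˡ , λ f n → trans (*ₛ-comm f 1ₛ n) (*ₛ-identityˡ f n)
          ; distrib = *ₛ-distribˡ , λ h f g n → trans (*ₛ-comm _ h n)
                        (trans (*ₛ-distribˡ h f g n) (+-cong (*ₛ-comm h f n) (*ₛ-comm h g n)))
          }
        ; zero = *ₛ-zeroˡ , λ f n → trans (*ₛ-comm f _ n) (*ₛ-zeroˡ f n)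
        }
      ; *-comm = *ₛ-comm
      }
    }

module TrivariateSeries where

  open import Data.Integer using (ℤ; _+_; _*_; 0ℤ)
  open import Data.Integer.Properties as ℤ using (+-*-commutativeSemiring)
  open import Relation.Binary.Bundles using (Setoid)
  open import Relation.Binary.Structures using (IsEquivalence)
  import Relation.Binary.Reasoning.Setoid

  module ℤ[[q]]     = PowerSeries +-*-commutativeSemiring
  module ℤ[[z,q]]   = PowerSeries ℤ[[q]].commutativeSemiring
  module ℤ[[x,z,q]] = PowerSeries ℤ[[z,q]].commutativeSemiring

  sumTo-cong : ∀ n {f g : ℕ → ℤ} → (∀ k → f k ≡ g k) → sumTo n f ≡ sumTo n g
  sumTo-cong zero    f≡g = ≡.refl
  sumTo-cong (suc n) f≡g = ≡.cong₂ _+_ (sumTo-cong n f≡g) (f≡g n)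

  ∑<-coeff₁ : ∀ n f → ℤ[[q]].∑< n f ≡ sumTo n f
  ∑<-coeff₁ zero    f = ≡.refl
  ∑<-coeff₁ (suc n) f = ≡.cong (_+ f n) (∑<-coeff₁ n f)

  ∑<-coeff₂ : ∀ n F N → ℤ[[z,q]].∑< n F N ≡ sumTo n (λ b → F b N)
  ∑<-coeff₂ zero    F N = ≡.refl
  ∑<-coeff₂ (suc n) F N = ≡.cong (_+ F n N) (∑<-coeff₂ n F N)

  ∑<-coeff₃ : ∀ n F j N → ℤ[[x,z,q]].∑< n F j N ≡ sumTo n (λ a → F a j N)
  ∑<-coeff₃ zero    F j N = ≡.refl
  ∑<-coeff₃ (suc n) F j N = ≡.cong (_+ F n j N) (∑<-coeff₃ n F j N)

  sumTo-distrib-+ : ∀ n (f g : ℕ → ℤ) → sumTo n (λ k → f k + g k) ≡ sumTo n f + sumTo n g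
  sumTo-distrib-+ n f g = begin
    sumTo n (λ k → f k + g k)                  ≡⟨ ∑<-coeff₁ n _ ⟨
    ℤ[[q]].∑< n (λ k → f k + g k)              ≡⟨ ℤ[[q]].∑<-distrib-+ n f g ⟩
    ℤ[[q]].∑< n f + ℤ[[q]].∑< n g              ≡⟨ ≡.cong₂ _+_ (∑<-coeff₁ n f) (∑<-coeff₁ n g) ⟩
    sumTo n f + sumTo n g                      ∎
    where open ≡.≡-Reasoning

  sumTo-cong< : ∀ n {f g : ℕ → ℤ} → (∀ k → k < n → f k ≡ g k) → sumTo n f ≡ sumTo n g
  sumTo-cong< zero    f≡g = ≡.refl
  sumTo-cong< (suc n) f≡g = ≡.cong₂ _+_ (sumTo-cong< n (λ k k<n → f≡g k (m<n⇒m<1+n k<n))) (f≡g n ≤-refl)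

  sumTo-zero : ∀ n {f : ℕ → ℤ} → (∀ k → k < n → f k ≡ 0ℤ) → sumTo n f ≡ 0ℤ
  sumTo-zero n f≡0 = ≡.trans (sumTo-cong< n f≡0) (zeros n)
    where
    zeros : ∀ n → sumTo n (λ _ → 0ℤ) ≡ 0ℤ
    zeros zero    = ≡.refl
    zeros (suc n) = ≡.trans (ℤ.+-identityʳ _) (zeros n)

  sumTo-single : ∀ n m {f : ℕ → ℤ} → m < n → (∀ k → k < n → k ≢ m → f k ≡ 0ℤ) → sumTo n f ≡ f m
  sumTo-single (suc n) m {f} m<1+n f≡0 with ℕ.m≤n⇒m<n∨m≡n (≤-pred m<1+n)
  ... | inj₁ m<n = begin
    sumTo n f + f n  ≡⟨ ≡.cong₂ _+_ (sumTo-single n m m<n (λ k k<n → f≡0 k (m<n⇒m<1+n k<n)))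
                                     (f≡0 n ≤-refl (≢-sym (ℕ.<⇒≢ m<n))) ⟩
    f m + 0ℤ         ≡⟨ ℤ.+-identityʳ _ ⟩
    f m              ∎
    where open ≡.≡-Reasoning
  ... | inj₂ ≡.refl = begin
    sumTo m f + f m  ≡⟨ ≡.cong (_+ f m) (sumTo-zero m (λ k k<m → f≡0 k (m<n⇒m<1+n k<m) (ℕ.<⇒≢ k<m))) ⟩
    0ℤ + f m         ≡⟨ ℤ.+-identityˡ _ ⟩
    f m              ∎
    where open ≡.≡-Reasoning

  sumTo-extend : ∀ n M {f : ℕ → ℤ} → n ≤ M → (∀ k → n ≤ k → k < M → f k ≡ 0ℤ) → sumTo M f ≡ sumTo n f
  sumTo-extend n zero    z≤n   _   = ≡.refl
  sumTo-extend n (suc M) n≤1+M f≡0 with ℕ.m≤n⇒m<n∨m≡n n≤1+M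
  ... | inj₂ ≡.refl = ≡.refl
  ... | inj₁ n<1+M = ≡.trans
    (≡.cong₂ _+_ (sumTo-extend n M (≤-pred n<1+M) (λ k n≤k k<M → f≡0 k n≤k (m<n⇒m<1+n k<M)))
                 (f≡0 M (≤-pred n<1+M) ≤-refl))
    (ℤ.+-identityʳ _)

  ⊗-coeff : ∀ f g i j N → (f ⊗ g) i j N ≡ ℤ[[x,z,q]]._*ₛ_ f g i j N
  ⊗-coeff f g i j N = ≡.sym (begin
    ℤ[[x,z,q]].∑< (suc i) (λ a → ℤ[[z,q]]._*ₛ_ (f a) (g (i ∸ a))) j N
      ≡⟨ ∑<-coeff₃ (suc i) _ j N ⟩
    sumTo (suc i) (λ a → ℤ[[z,q]].∑< (suc j) (λ b → ℤ[[q]]._*ₛ_ (f a b) (g (i ∸ a) (j ∸ b))) N)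
      ≡⟨ sumTo-cong (suc i) (λ a → ∑<-coeff₂ (suc j) _ N) ⟩
    sumTo (suc i) (λ a → sumTo (suc j) (λ b → ℤ[[q]]._*ₛ_ (f a b) (g (i ∸ a) (j ∸ b)) N))
      ≡⟨ sumTo-cong (suc i) (λ a → sumTo-cong (suc j) (λ b → ∑<-coeff₁ (suc N) _)) ⟩
    (f ⊗ g) i j N ∎)
    where open ≡.≡-Reasoning

  infix 4 _≈F_

  record _≈F_ (f g : FPS) : Set where
    constructor mk≈F
    field coeff : ∀ i j N → f i j N ≡ g i j N

  open _≈F_ public

  ≈F-isEquivalence : IsEquivalence _≈F_
  ≈F-isEquivalence = record
    { refl  = mk≈F (λ _ _ _ → ≡.refl)
    ; sym   = λ f≈g → mk≈F (λ i j N → ≡.sym (coeff f≈g i j N))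
    ; trans = λ f≈g g≈h → mk≈F (λ i j N → ≡.trans (coeff f≈g i j N) (coeff g≈h i j N))
    }

  open IsEquivalence ≈F-isEquivalence public
    using () renaming (refl to ≈F-refl; sym to ≈F-sym; trans to ≈F-trans)

  ≈F-setoid : Setoid 0ℓ 0ℓ
  ≈F-setoid = record { isEquivalence = ≈F-isEquivalence }

  module ≈F-Reasoning = Relation.Binary.Reasoning.Setoid ≈F-setoid

  0F : FPS
  0F _ _ _ = 0ℤ

  private
    module Z = CommutativeSemiring ℤ[[x,z,q]].commutativeSemiring
    open ≈F-Reasoning

    ⊕-cong : ∀ {f f′ g g′} → f ≈F f′ → g ≈F g′ → f ⊕ g ≈F f′ ⊕ g′
    ⊕-cong f≈f′ g≈g′ = mk≈F (λ i j N → ≡.cong₂ _+_ (coeff f≈f′ i j N) (coeff g≈g′ i j N))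

    ⊗≈* : ∀ f g → f ⊗ g ≈F f Z.* g
    ⊗≈* f g = mk≈F (⊗-coeff f g)

    ⊗-cong : ∀ {f f′ g g′} → f ≈F f′ → g ≈F g′ → f ⊗ g ≈F f′ ⊗ g′
    ⊗-cong {f} {f′} {g} {g′} f≈f′ g≈g′ = begin
      f ⊗ g     ≈⟨ ⊗≈* f g ⟩
      f Z.* g   ≈⟨ mk≈F (Z.*-cong {f} {f′} {g} {g′} (coeff f≈f′) (coeff g≈g′)) ⟩
      f′ Z.* g′ ≈⟨ ⊗≈* f′ g′ ⟨
      f′ ⊗ g′   ∎

    ⊗-assoc : ∀ f g h → (f ⊗ g) ⊗ h ≈F f ⊗ (g ⊗ h)
    ⊗-assoc f g h = begin
      (f ⊗ g) ⊗ h       ≈⟨ ⊗-cong (⊗≈* f g) (≈F-refl {h}) ⟩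
      (f Z.* g) ⊗ h     ≈⟨ ⊗≈* (f Z.* g) h ⟩
      (f Z.* g) Z.* h   ≈⟨ mk≈F (Z.*-assoc f g h) ⟩
      f Z.* (g Z.* h)   ≈⟨ ⊗≈* f (g Z.* h) ⟨
      f ⊗ (g Z.* h)     ≈⟨ ⊗-cong (≈F-refl {f}) (⊗≈* g h) ⟨
      f ⊗ (g ⊗ h)       ∎

    ⊗-comm : ∀ f g → f ⊗ g ≈F g ⊗ f
    ⊗-comm f g = begin
      f ⊗ g     ≈⟨ ⊗≈* f g ⟩
      f Z.* g   ≈⟨ mk≈F (Z.*-comm f g) ⟩
      g Z.* f   ≈⟨ ⊗≈* g f ⟨
      g ⊗ f     ∎

    one≈1# : one ≈F Z.1#
    one≈1# = mk≈F coeffs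
      where
      coeffs : ∀ i j N → one i j N ≡ Z.1# i j N
      coeffs zero    zero    zero    = ≡.refl
      coeffs zero    zero    (suc N) = ≡.refl
      coeffs zero    (suc j) N       = ≡.refl
      coeffs (suc i) j       N       = ≡.refl

    ⊗-identityˡ : ∀ f → one ⊗ f ≈F f
    ⊗-identityˡ f = begin
      one ⊗ f     ≈⟨ ⊗-cong one≈1# (≈F-refl {f}) ⟩
      Z.1# ⊗ f    ≈⟨ ⊗≈* Z.1# f ⟩
      Z.1# Z.* f  ≈⟨ mk≈F (Z.*-identityˡ f) ⟩
      f           ∎

    ⊗-zeroˡ : ∀ f → 0F ⊗ f ≈F 0F
    ⊗-zeroˡ f = ≈F-trans (⊗≈* 0F f) (mk≈F (Z.zeroˡ f))

    ⊗-distribˡ : ∀ f g h → f ⊗ (g ⊕ h) ≈F (f ⊗ g) ⊕ (f ⊗ h)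
    ⊗-distribˡ f g h = begin
      f ⊗ (g ⊕ h)               ≈⟨ ⊗≈* f (g ⊕ h) ⟩
      f Z.* (g ⊕ h)             ≈⟨ mk≈F (Z.distribˡ f g h) ⟩
      (f Z.* g) ⊕ (f Z.* h)     ≈⟨ ⊕-cong (⊗≈* f g) (⊗≈* f h) ⟨
      (f ⊗ g) ⊕ (f ⊗ h)         ∎

  ⊕-⊗-isCommutativeSemiring : IsCommutativeSemiring _≈F_ _⊕_ _⊗_ 0F one
  ⊕-⊗-isCommutativeSemiring = record
    { isSemiring = record
      { isSemiringWithoutAnnihilatingZero = record
        { +-isCommutativeMonoid = record
          { isMonoid = record
            { isSemigroup = record
              { isMagma = record { isEquivalence = ≈F-isEquivalence ; ∙-cong = ⊕-cong }
              ; assoc = λ f g h → mk≈F (Z.+-assoc f g h)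
              }
            ; identity = (λ f → mk≈F (Z.+-identityˡ f)) , (λ f → mk≈F (Z.+-identityʳ f))
            }
          ; comm = λ f g → mk≈F (Z.+-comm f g)
          }
        ; *-cong = ⊗-cong
        ; *-assoc = ⊗-assoc
        ; *-identity = ⊗-identityˡ , λ f → ≈F-trans (⊗-comm f one) (⊗-identityˡ f)
        ; distrib = ⊗-distribˡ , λ h f g → ≈F-trans (⊗-comm (f ⊕ g) h)
                      (≈F-trans (⊗-distribˡ h f g) (⊕-cong (⊗-comm h f) (⊗-comm h g)))
        }
      ; zero = ⊗-zeroˡ , λ f → ≈F-trans (⊗-comm f 0F) (⊗-zeroˡ f)
      }
    ; *-comm = ⊗-comm
    }

  module FPS = IsCommutativeSemiring ⊕-⊗-isCommutativeSemiring

-- The operations are parameters rather than fields of a bundle so that, once instantiated,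
-- these identities mention _⊕_ and _⊗_ literally and are matched against the series
-- without unfolding the Cauchy products.
module SemiringIdentities
  {c ℓ} {A : Set c} {_≈_ : Rel A ℓ} {_+_ _*_ : Op₂ A} {0# 1# : A}
  (isCommutativeSemiring : IsCommutativeSemiring _≈_ _+_ _*_ 0# 1#) where

  open IsCommutativeSemiring isCommutativeSemiring

  private
    bundle : CommutativeSemiring c ℓ
    bundle = record { isCommutativeSemiring = isCommutativeSemiring }

  open import Algebra.Solver.Ring.NaturalCoefficients.Default bundle
  open import Relation.Binary.Reasoning.Setoid setoid

  geometric-absorb : ∀ β γ I → I ≈ (1# + (β * I)) → ((1# + γ) * I) ≈ (1# + ((β + γ) * I))
  geometric-absorb β γ I I≈1+βI = begin
    (1# + γ) * I              ≈⟨ solve 2 (λ γ I → (con 1 :+ γ) :* I := I :+ γ :* I) refl γ I ⟩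
    I + (γ * I)               ≈⟨ +-congʳ I≈1+βI ⟩
    (1# + (β * I)) + (γ * I)  ≈⟨ solve 3 (λ β γ I → con 1 :+ β :* I :+ γ :* I := con 1 :+ (β :+ γ) :* I) refl β γ I ⟩
    1# + ((β + γ) * I)        ∎

  geometric-step : ∀ m S P → ((1# + (m * S)) + (P * m)) ≈ (1# + (m * (S + P)))
  geometric-step = solve 3 (λ m S P → con 1 :+ m :* S :+ P :* m := con 1 :+ m :* (S :+ P)) refl

  partialProduct-step : ∀ A C P α β γ Iα Iβ → Iα ≈ (1# + (α * Iα)) → Iβ ≈ (1# + (β * Iβ)) →
    (((A * C) * P) + (((((β + γ) * A) * C) * (P * Iβ)) + (((α * (A * (1# + γ))) * (C * Iα)) * (P * Iβ))))
      ≈ (((A * (1# + γ)) * (C * Iα)) * (P * Iβ))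
  partialProduct-step A C P α β γ Iα Iβ Iα≈1+αIα Iβ≈1+βIβ = begin
    ((A * C) * P) + (((((β + γ) * A) * C) * (P * Iβ)) + (((α * (A * (1# + γ))) * (C * Iα)) * (P * Iβ)))
      ≈⟨ solve 8 (λ A C P α β γ Iα Iβ →
           A :* C :* P :+ ((β :+ γ) :* A :* C :* (P :* Iβ) :+ α :* (A :* (con 1 :+ γ)) :* (C :* Iα) :* (P :* Iβ))
           := A :* C :* P :* (con 1 :+ (β :+ γ) :* Iβ :+ α :* ((con 1 :+ γ) :* Iβ) :* Iα))
           refl A C P α β γ Iα Iβ ⟩
    ((A * C) * P) * ((1# + ((β + γ) * Iβ)) + ((α * ((1# + γ) * Iβ)) * Iα))
      ≈⟨ *-congˡ (+-congʳ (geometric-absorb β γ Iβ Iβ≈1+βIβ)) ⟨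
    ((A * C) * P) * (((1# + γ) * Iβ) + ((α * ((1# + γ) * Iβ)) * Iα))
      ≈⟨ solve 4 (λ X Y α Iα → X :* (Y :+ α :* Y :* Iα) := X :* (Y :* (con 1 :+ α :* Iα)))
           refl ((A * C) * P) ((1# + γ) * Iβ) α Iα ⟩
    ((A * C) * P) * (((1# + γ) * Iβ) * (1# + (α * Iα)))
      ≈⟨ *-congˡ (*-congˡ Iα≈1+αIα) ⟨
    ((A * C) * P) * (((1# + γ) * Iβ) * Iα)
      ≈⟨ solve 6 (λ A C P γ Iα Iβ → A :* C :* P :* ((con 1 :+ γ) :* Iβ :* Iα)
                                     := A :* (con 1 :+ γ) :* (C :* Iα) :* (P :* Iβ)) refl A C P γ Iα Iβ ⟩
    ((A * (1# + γ)) * (C * Iα)) * (P * Iβ) ∎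

  shiftedProduct-step : ∀ s u u′ q ν γ A → (u * q) ≈ u′ → (u * ν) ≈ (u′ * γ) →
    (((s * u) * A) * (q + ν)) ≈ ((s * u′) * (A * (1# + γ)))
  shiftedProduct-step s u u′ q ν γ A uq≈u′ uν≈u′γ = begin
    ((s * u) * A) * (q + ν)          ≈⟨ solve 5 (λ s u A q ν → s :* u :* A :* (q :+ ν) := s :* A :* (u :* q :+ u :* ν))
                                          refl s u A q ν ⟩
    (s * A) * ((u * q) + (u * ν))    ≈⟨ *-congˡ (+-cong uq≈u′ uν≈u′γ) ⟩
    (s * A) * (u′ + (u′ * γ))        ≈⟨ solve 4 (λ s A u′ γ → s :* A :* (u′ :+ u′ :* γ)
                                                   := s :* u′ :* (A :* (con 1 :+ γ))) refl s A u′ γ ⟩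
    (s * u′) * (A * (1# + γ))        ∎

  regroup : ∀ a b c a′ b′ c′ → (((a * b) * c) * ((a′ * b′) * c′)) ≈ (((a * a′) * (b * b′)) * (c * c′))
  regroup = solve 6 (λ a b c a′ b′ c′ → a :* b :* c :* (a′ :* b′ :* c′) := a :* a′ :* (b :* b′) :* (c :* c′)) refl

module Monomials where

  open TrivariateSeries
  open import Data.Empty using (⊥-elim)
  open import Data.Integer using (ℤ; _+_; _*_; -_; _-_; 0ℤ; 1ℤ)
  import Data.Integer.Properties as ℤ
  open import Data.Nat using (_≟_; _≤?_)
  open import Function.Bundles using (mk⇔)
  open import Relation.Nullary using (¬_; yes; no)
  open import Relation.Nullary.Decidable using (⌊_⌋; isYes≗does; does-⇔; _×-dec_)

  mono-hit : ∀ c a b d → mono c a b d a b d ≡ c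
  mono-hit c a b d rewrite ℕ.≟-diag (≡.refl {x = a}) | ℕ.≟-diag (≡.refl {x = b}) | ℕ.≟-diag (≡.refl {x = d}) = ≡.refl

  mono-miss : ∀ c a b d i j N → ¬ (i ≡ a × j ≡ b × N ≡ d) → mono c a b d i j N ≡ 0ℤ
  mono-miss c a b d i j N ≢abd with i ≟ a | j ≟ b | N ≟ d
  ... | yes i≡a | yes j≡b | yes N≡d = ⊥-elim (≢abd (i≡a , j≡b , N≡d))
  ... | yes _   | yes _   | no _    = ≡.refl
  ... | yes _   | no _    | _       = ≡.refl
  ... | no _    | _       | _       = ≡.refl

  mono-cong : ∀ c a b {d d′} → d ≡ d′ → mono c a b d ≈F mono c a b d′
  mono-cong c a b ≡.refl = ≈F-refl

  ≟-+ˡ : ∀ a m n → ⌊ a +ℕ m ≟ a +ℕ n ⌋ ≡ ⌊ m ≟ n ⌋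
  ≟-+ˡ a m n = ≡.trans (isYes≗does (a +ℕ m ≟ a +ℕ n))
    (≡.trans (does-⇔ (mk⇔ (ℕ.+-cancelˡ-≡ a m n) (≡.cong (a +ℕ_))) (a +ℕ m ≟ a +ℕ n) (m ≟ n))
             (≡.sym (isYes≗does (m ≟ n))))

  mono-shift : ∀ c a b d a′ b′ d′ i j N →
    mono c (a +ℕ a′) (b +ℕ b′) (d +ℕ d′) (a +ℕ i) (b +ℕ j) (d +ℕ N) ≡ mono c a′ b′ d′ i j N
  mono-shift c a b d a′ b′ d′ i j N rewrite ≟-+ˡ a i a′ | ≟-+ˡ b j b′ | ≟-+ˡ d N d′ = ≡.refl

  mono⊗-hit : ∀ c a b d f i j N → a ≤ i → b ≤ j → d ≤ N →
    (mono c a b d ⊗ f) i j N ≡ c * f (i ∸ a) (j ∸ b) (N ∸ d)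
  mono⊗-hit c a b d f i j N a≤i b≤j d≤N =
    ≡.trans (sumTo-single (suc i) a (s≤s a≤i) λ a′ _ a′≢a →
               sumTo-zero (suc j) λ b′ _ → sumTo-zero (suc N) λ d′ _ →
                 term≡0 a′ b′ d′ (λ (a′≡a , _ , _) → a′≢a a′≡a))
    (≡.trans (sumTo-single (suc j) b (s≤s b≤j) λ b′ _ b′≢b →
               sumTo-zero (suc N) λ d′ _ → term≡0 a b′ d′ (λ (_ , b′≡b , _) → b′≢b b′≡b))
    (≡.trans (sumTo-single (suc N) d (s≤s d≤N) λ d′ _ d′≢d → term≡0 a b d′ (λ (_ , _ , d′≡d) → d′≢d d′≡d))
             (≡.cong (_* f (i ∸ a) (j ∸ b) (N ∸ d)) (mono-hit c a b d))))
    where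
    term≡0 : ∀ a′ b′ d′ → ¬ (a′ ≡ a × b′ ≡ b × d′ ≡ d) → mono c a b d a′ b′ d′ * f (i ∸ a′) (j ∸ b′) (N ∸ d′) ≡ 0ℤ
    term≡0 a′ b′ d′ ≢abd = ≡.cong (_* f (i ∸ a′) (j ∸ b′) (N ∸ d′)) (mono-miss c a b d a′ b′ d′ ≢abd)

  mono⊗-miss : ∀ c a b d f i j N → ¬ (a ≤ i × b ≤ j × d ≤ N) → (mono c a b d ⊗ f) i j N ≡ 0ℤ
  mono⊗-miss c a b d f i j N ≰ =
    sumTo-zero (suc i) λ a′ a′<1+i → sumTo-zero (suc j) λ b′ b′<1+j → sumTo-zero (suc N) λ d′ d′<1+N →
      ≡.cong (_* f (i ∸ a′) (j ∸ b′) (N ∸ d′)) (mono-miss c a b d a′ b′ d′ λ where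
        (≡.refl , ≡.refl , ≡.refl) → ≰ (≤-pred a′<1+i , ≤-pred b′<1+j , ≤-pred d′<1+N))

  mono⊗mono : ∀ a b d a′ b′ d′ → mono 1ℤ a b d ⊗ mono 1ℤ a′ b′ d′ ≈F mono 1ℤ (a +ℕ a′) (b +ℕ b′) (d +ℕ d′)
  mono⊗mono a b d a′ b′ d′ = mk≈F coeffs
    where
    coeffs : ∀ i j N → (mono 1ℤ a b d ⊗ mono 1ℤ a′ b′ d′) i j N ≡ mono 1ℤ (a +ℕ a′) (b +ℕ b′) (d +ℕ d′) i j N
    coeffs i j N with a ≤? i ×-dec b ≤? j ×-dec d ≤? N
    ... | yes (a≤i , b≤j , d≤N) = begin
      (mono 1ℤ a b d ⊗ mono 1ℤ a′ b′ d′) i j N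
        ≡⟨ mono⊗-hit 1ℤ a b d (mono 1ℤ a′ b′ d′) i j N a≤i b≤j d≤N ⟩
      1ℤ * mono 1ℤ a′ b′ d′ (i ∸ a) (j ∸ b) (N ∸ d)
        ≡⟨ ℤ.*-identityˡ _ ⟩
      mono 1ℤ a′ b′ d′ (i ∸ a) (j ∸ b) (N ∸ d)
        ≡⟨ mono-shift 1ℤ a b d a′ b′ d′ (i ∸ a) (j ∸ b) (N ∸ d) ⟨
      mono 1ℤ (a +ℕ a′) (b +ℕ b′) (d +ℕ d′) (a +ℕ (i ∸ a)) (b +ℕ (j ∸ b)) (d +ℕ (N ∸ d))
        ≡⟨ ≡.cong₂ (λ i′ (jN : ℕ × ℕ) → mono 1ℤ (a +ℕ a′) (b +ℕ b′) (d +ℕ d′) i′ (proj₁ jN) (proj₂ jN))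
             (ℕ.m+[n∸m]≡n a≤i) (≡.cong₂ _,_ (ℕ.m+[n∸m]≡n b≤j) (ℕ.m+[n∸m]≡n d≤N)) ⟩
      mono 1ℤ (a +ℕ a′) (b +ℕ b′) (d +ℕ d′) i j N ∎
      where open ≡.≡-Reasoning
    ... | no ≰ = ≡.trans (mono⊗-miss 1ℤ a b d (mono 1ℤ a′ b′ d′) i j N ≰) (≡.sym (mono-miss 1ℤ _ _ _ i j N λ where
      (≡.refl , ≡.refl , ≡.refl) → ≰ (ℕ.m≤m+n a a′ , ℕ.m≤m+n b b′ , ℕ.m≤m+n d d′)))

  pow-mono : ∀ a b d n → pow (mono 1ℤ a b d) n ≈F mono 1ℤ (n *ℕ a) (n *ℕ b) (n *ℕ d)
  pow-mono a b d zero    = ≈F-refl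
  pow-mono a b d (suc n) = begin
    pow (mono 1ℤ a b d) n ⊗ mono 1ℤ a b d                   ≈⟨ FPS.*-comm (pow (mono 1ℤ a b d) n) (mono 1ℤ a b d) ⟩
    mono 1ℤ a b d ⊗ pow (mono 1ℤ a b d) n                   ≈⟨ FPS.*-congˡ {mono 1ℤ a b d} (pow-mono a b d n) ⟩
    mono 1ℤ a b d ⊗ mono 1ℤ (n *ℕ a) (n *ℕ b) (n *ℕ d)      ≈⟨ mono⊗mono a b d (n *ℕ a) (n *ℕ b) (n *ℕ d) ⟩
    mono 1ℤ (suc n *ℕ a) (suc n *ℕ b) (suc n *ℕ d)          ∎
    where open ≈F-Reasoning

  one⊖neg-mono : ∀ a b d → one ⊖ mono (- 1ℤ) a b d ≈F one ⊕ mono 1ℤ a b d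
  one⊖neg-mono a b d = mk≈F coeffs
    where
    coeffs : ∀ i j N → one i j N - mono (- 1ℤ) a b d i j N ≡ one i j N + mono 1ℤ a b d i j N
    coeffs i j N with ⌊ i ≟ a ⌋ | ⌊ j ≟ b ⌋ | ⌊ N ≟ d ⌋
    ... | true  | true  | true  = ≡.refl
    ... | true  | true  | false = ≡.refl
    ... | true  | false | _     = ≡.refl
    ... | false | _     | _     = ≡.refl

module Truncation where

  open TrivariateSeries
  open Monomials
  open import Data.Integer using (ℤ; _+_; _*_; -_; _-_; 0ℤ; 1ℤ)
  import Data.Integer.Properties as ℤ
  open SemiringIdentities ⊕-⊗-isCommutativeSemiring using (geometric-step; regroup)
  open import Relation.Binary.Bundles using (Setoid)
  import Relation.Binary.Reasoning.Setoid

  infix 4 _≈[_]_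

  record _≈[_]_ (f : FPS) (N : ℕ) (g : FPS) : Set where
    constructor mk≈[]
    field coeff≤ : ∀ i j n → n ≤ N → f i j n ≡ g i j n

  open _≈[_]_ public

  ≈[]-all⇒≈F : ∀ {f g} → (∀ N → f ≈[ N ] g) → f ≈F g
  ≈[]-all⇒≈F f≈g = mk≈F (λ i j N → coeff≤ (f≈g N) i j N ≤-refl)

  ≈F⇒≈[] : ∀ {f g} N → f ≈F g → f ≈[ N ] g
  ≈F⇒≈[] N f≈g = mk≈[] (λ i j n _ → coeff f≈g i j n)

  ≈[]-sym : ∀ {f g N} → f ≈[ N ] g → g ≈[ N ] f
  ≈[]-sym f≈g = mk≈[] (λ i j n n≤N → ≡.sym (coeff≤ f≈g i j n n≤N))

  ≈[]-trans : ∀ {f g h N} → f ≈[ N ] g → g ≈[ N ] h → f ≈[ N ] h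
  ≈[]-trans f≈g g≈h = mk≈[] (λ i j n n≤N → ≡.trans (coeff≤ f≈g i j n n≤N) (coeff≤ g≈h i j n n≤N))

  ≈[]-refl : ∀ {f N} → f ≈[ N ] f
  ≈[]-refl = mk≈[] (λ _ _ _ _ → ≡.refl)

  ≈[]-setoid : ℕ → Setoid 0ℓ 0ℓ
  ≈[]-setoid N = record
    { _≈_ = _≈[ N ]_
    ; isEquivalence = record { refl = ≈[]-refl ; sym = ≈[]-sym ; trans = ≈[]-trans }
    }

  module ≈[]-Reasoning N = Relation.Binary.Reasoning.Setoid (≈[]-setoid N)

  ≈[]-weaken : ∀ {f g M N} → M ≤ N → f ≈[ N ] g → f ≈[ M ] g
  ≈[]-weaken M≤N f≈g = mk≈[] (λ i j n n≤M → coeff≤ f≈g i j n (ℕ.≤-trans n≤M M≤N))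

  ⊗-cong≤ : ∀ {f f′ g g′ N} → f ≈[ N ] f′ → g ≈[ N ] g′ → f ⊗ g ≈[ N ] f′ ⊗ g′
  ⊗-cong≤ f≈f′ g≈g′ = mk≈[] λ i j n n≤N →
    sumTo-cong (suc i) λ a → sumTo-cong (suc j) λ b → sumTo-cong< (suc n) λ c c<1+n →
      ≡.cong₂ _*_ (coeff≤ f≈f′ a b c (ℕ.≤-trans (≤-pred c<1+n) n≤N))
                  (coeff≤ g≈g′ (i ∸ a) (j ∸ b) (n ∸ c) (ℕ.≤-trans (ℕ.m∸n≤m n c) n≤N))

  ⊕-cong≤ : ∀ {f f′ g g′ N} → f ≈[ N ] f′ → g ≈[ N ] g′ → f ⊕ g ≈[ N ] f′ ⊕ g′
  ⊕-cong≤ f≈f′ g≈g′ = mk≈[] λ i j n n≤N → ≡.cong₂ _+_ (coeff≤ f≈f′ i j n n≤N) (coeff≤ g≈g′ i j n n≤N)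

  ∑F : ℕ → (ℕ → FPS) → FPS
  ∑F n F i j N = sumTo n (λ k → F k i j N)

  ∑F-pow-suc : ∀ m M → ∑F (suc M) (pow m) ≈F one ⊕ m ⊗ ∑F M (pow m)
  ∑F-pow-suc m zero = FPS.trans (FPS.+-comm 0F one) (FPS.+-congˡ {one} (FPS.sym (FPS.zeroʳ m)))
  ∑F-pow-suc m (suc M) = begin
    ∑F (suc M) (pow m) ⊕ pow m M ⊗ m            ≈⟨ FPS.+-congʳ {pow m M ⊗ m} (∑F-pow-suc m M) ⟩
    one ⊕ m ⊗ ∑F M (pow m) ⊕ pow m M ⊗ m        ≈⟨ geometric-step m (∑F M (pow m)) (pow m M) ⟩
    one ⊕ m ⊗ ∑F (suc M) (pow m)                ∎
    where open ≈F-Reasoning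

  pow-mono-vanishes : ∀ a b D t i j n → n < t *ℕ D → pow (mono 1ℤ a b D) t i j n ≡ 0ℤ
  pow-mono-vanishes a b D t i j n n<tD = ≡.trans (coeff (pow-mono a b D t) i j n)
    (mono-miss 1ℤ _ _ _ i j n (λ (_ , _ , n≡tD) → ℕ.<-irrefl n≡tD n<tD))

  inv1m≈[]∑F : ∀ a b D N M → 1 ≤ D → N < M → inv1m (mono 1ℤ a b D) ≈[ N ] ∑F M (pow (mono 1ℤ a b D))
  inv1m≈[]∑F a b D N M 1≤D N<M = mk≈[] λ i j n n≤N →
    ≡.sym (sumTo-extend (suc n) M (ℕ.≤-<-trans n≤N N<M) λ t n<t _ →
      pow-mono-vanishes a b D t i j n (ℕ.<-≤-trans n<t (ℕ.m≤m*n t D {{>-nonZero 1≤D}})))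

  inv1m-unfold : ∀ a b D → 1 ≤ D → inv1m (mono 1ℤ a b D) ≈F one ⊕ mono 1ℤ a b D ⊗ inv1m (mono 1ℤ a b D)
  inv1m-unfold a b D 1≤D = ≈[]-all⇒≈F unfold≤
    where
    m = mono 1ℤ a b D
    unfold≤ : ∀ N → inv1m m ≈[ N ] one ⊕ m ⊗ inv1m m
    unfold≤ N = begin
      inv1m m                         ≈⟨ inv1m≈[]∑F a b D N (suc (suc N)) 1≤D (ℕ.m<n⇒m<1+n (ℕ.n<1+n N)) ⟩
      ∑F (suc (suc N)) (pow m)        ≈⟨ ≈F⇒≈[] N (∑F-pow-suc m (suc N)) ⟩
      one ⊕ m ⊗ ∑F (suc N) (pow m)    ≈⟨ ⊕-cong≤ (≈[]-refl {one}) (⊗-cong≤ (≈[]-refl {m})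
                                           (≈[]-sym (inv1m≈[]∑F a b D N (suc N) 1≤D ≤-refl))) ⟩
      one ⊕ m ⊗ inv1m m               ∎
      where open ≈[]-Reasoning N

  one⊖mono≈[]one : ∀ c a b D k → k < D → one ⊖ mono c a b D ≈[ k ] one
  one⊖mono≈[]one c a b D k k<D = mk≈[] λ i j n n≤k →
    ≡.trans (≡.cong (λ x → one i j n - x)
               (mono-miss c a b D i j n (λ (_ , _ , n≡D) → ℕ.<-irrefl n≡D (ℕ.≤-<-trans n≤k k<D))))
            (ℤ.+-identityʳ _)

  inv1m≈[]one : ∀ a b D k → k < D → inv1m (mono 1ℤ a b D) ≈[ k ] one
  inv1m≈[]one a b D k k<D = mk≈[] λ i j n n≤k →
    ≡.trans (sumTo-extend 1 (suc n) (s≤s z≤n) λ t 1≤t _ →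
               pow-mono-vanishes a b D t i j n (ℕ.≤-<-trans n≤k (ℕ.<-≤-trans k<D (ℕ.m≤n*m D t {{>-nonZero 1≤t}}))))
            (ℤ.+-identityˡ _)

  prodFin-stable : ∀ (F : ℕ → FPS) → (∀ k → F k ≈[ k ] one) → ∀ m M → m ≤ M → prodFin F M ≈[ m ] prodFin F m
  prodFin-stable F F≈1 m zero    z≤n   = ≈[]-refl
  prodFin-stable F F≈1 m (suc M) m≤1+M with ℕ.m≤n⇒m<n∨m≡n m≤1+M
  ... | inj₂ ≡.refl = ≈[]-refl
  ... | inj₁ m<1+M = begin
    prodFin F M ⊗ F M    ≈⟨ ⊗-cong≤ (≈[]-refl {prodFin F M}) (≈[]-weaken (≤-pred m<1+M) (F≈1 M)) ⟩
    prodFin F M ⊗ one    ≈⟨ ≈F⇒≈[] m (FPS.*-identityʳ (prodFin F M)) ⟩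
    prodFin F M          ≈⟨ prodFin-stable F F≈1 m M (≤-pred m<1+M) ⟩
    prodFin F m          ∎
    where open ≈[]-Reasoning m

  prodInf≈[]prodFin : ∀ (F : ℕ → FPS) → (∀ k → F k ≈[ k ] one) → ∀ N M → N ≤ M → prodInf F ≈[ N ] prodFin F M
  prodInf≈[]prodFin F F≈1 N M N≤M = mk≈[] λ i j n n≤N → ≡.trans
    (coeff≤ (prodFin-stable F F≈1 n (suc n) (ℕ.n≤1+n n)) i j n ≤-refl)
    (≡.sym (coeff≤ (prodFin-stable F F≈1 n M (ℕ.≤-trans n≤N N≤M)) i j n ≤-refl))

  prodFin-⊗³ : ∀ (A B C : ℕ → FPS) n → prodFin (λ k → A k ⊗ B k ⊗ C k) n ≈F prodFin A n ⊗ prodFin B n ⊗ prodFin C n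
  prodFin-⊗³ A B C zero    = FPS.sym (FPS.trans (FPS.*-identityʳ (one ⊗ one)) (FPS.*-identityʳ one))
  prodFin-⊗³ A B C (suc n) = FPS.trans (FPS.*-congʳ {A n ⊗ B n ⊗ C n} (prodFin-⊗³ A B C n))
                                       (regroup (prodFin A n) (prodFin B n) (prodFin C n) (A n) (B n) (C n))

module SumSide (e d : ℕ) (e+d≡4 : e +ℕ d ≡ 4) (1≤d : 1 ≤ d) where

  open TrivariateSeries
  open Monomials
  open Truncation
  open SemiringIdentities ⊕-⊗-isCommutativeSemiring
  open import Data.Integer using (-_; 1ℤ)
  open import Data.Nat.Solver using (module +-*-Solver)

  term₁ term₂ partialProduct : ℕ → FPS
  term₁ n = shiftedPoch4 e n ⊗ invPoch4 1ℤ 0 2 2 n ⊗ invPoch4 1ℤ 0 0 4 n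
  term₂ n = mono 1ℤ 0 2 (4 *ℕ n +ℕ 2) ⊗ poch4 (- 1ℤ) 1 1 d n ⊗ invPoch4 1ℤ 0 2 2 (suc n) ⊗ invPoch4 1ℤ 0 0 4 n
  partialProduct M = poch4 (- 1ℤ) 1 1 d M ⊗ invPoch4 1ℤ 0 2 2 (suc M) ⊗ invPoch4 1ℤ 0 0 4 M

  sumSide productSide : FPS
  sumSide     = sumInf (λ n → shiftedPoch4 e n ⊗ invPoch4 1ℤ 0 2 2 n ⊗ invPoch4 1ℤ 0 0 4 n)
                ⊕ sumInf (λ n → mono 1ℤ 0 2 (4 *ℕ n +ℕ 2) ⊗ poch4 (- 1ℤ) 1 1 d n
                                 ⊗ invPoch4 1ℤ 0 2 2 (suc n) ⊗ invPoch4 1ℤ 0 0 4 n)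
  productSide = poch4∞ (- 1ℤ) 1 1 d ⊗ invPoch4∞ 1ℤ 0 2 2 ⊗ invPoch4∞ 1ℤ 0 0 4

  d+e≡4 : d +ℕ e ≡ 4
  d+e≡4 = ≡.trans (ℕ.+-comm d e) e+d≡4

  q^ xzq^ : ℕ → FPS
  q^ n   = mono 1ℤ 0 0 n
  xzq^ n = mono 1ℤ 1 1 n

  α β γ : ℕ → FPS
  α M = mono 1ℤ 0 2 (2 +ℕ 4 *ℕ suc M)
  β M = q^ (4 +ℕ 4 *ℕ M)
  γ M = xzq^ (d +ℕ 4 *ℕ M)

  q^⊗q^4 : ∀ M → q^ (4 *ℕ M) ⊗ q^ 4 ≈F q^ (4 *ℕ suc M)
  q^⊗q^4 M = FPS.trans (mono⊗mono 0 0 (4 *ℕ M) 0 0 4)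
                       (mono-cong 1ℤ 0 0 (≡.trans (ℕ.+-comm (4 *ℕ M) 4) (≡.sym (ℕ.*-suc 4 M))))

  exponent-shift : ∀ M → 4 *ℕ M +ℕ (4 *ℕ suc M +ℕ 4 ∸ e) ≡ 4 *ℕ suc M +ℕ (d +ℕ 4 *ℕ M)
  exponent-shift M = begin
    4 *ℕ M +ℕ (4 *ℕ suc M +ℕ 4 ∸ e)        ≡⟨ ≡.cong (λ x → 4 *ℕ M +ℕ (4 *ℕ suc M +ℕ x ∸ e)) d+e≡4 ⟨
    4 *ℕ M +ℕ (4 *ℕ suc M +ℕ (d +ℕ e) ∸ e) ≡⟨ ≡.cong (λ x → 4 *ℕ M +ℕ (x ∸ e)) (ℕ.+-assoc (4 *ℕ suc M) d e) ⟨
    4 *ℕ M +ℕ (4 *ℕ suc M +ℕ d +ℕ e ∸ e)   ≡⟨ ≡.cong (4 *ℕ M +ℕ_) (ℕ.m+n∸n≡m (4 *ℕ suc M +ℕ d) e) ⟩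
    4 *ℕ M +ℕ (4 *ℕ suc M +ℕ d)            ≡⟨ solve 3 (λ m s d → m :+ (s :+ d) := s :+ (d :+ m)) ≡.refl
                                                      (4 *ℕ M) (4 *ℕ suc M) d ⟩
    4 *ℕ suc M +ℕ (d +ℕ 4 *ℕ M)            ∎
    where
    open ≡.≡-Reasoning
    open +-*-Solver using (solve; _:=_; _:+_)

  q^⊗xzq^ : ∀ M → q^ (4 *ℕ M) ⊗ xzq^ (4 *ℕ suc M +ℕ 4 ∸ e) ≈F q^ (4 *ℕ suc M) ⊗ γ M
  q^⊗xzq^ M = begin
    q^ (4 *ℕ M) ⊗ xzq^ (4 *ℕ suc M +ℕ 4 ∸ e)     ≈⟨ mono⊗mono 0 0 (4 *ℕ M) 1 1 (4 *ℕ suc M +ℕ 4 ∸ e) ⟩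
    xzq^ (4 *ℕ M +ℕ (4 *ℕ suc M +ℕ 4 ∸ e))        ≈⟨ mono-cong 1ℤ 1 1 (exponent-shift M) ⟩
    xzq^ (4 *ℕ suc M +ℕ (d +ℕ 4 *ℕ M))            ≈⟨ mono⊗mono 0 0 (4 *ℕ suc M) 1 1 (d +ℕ 4 *ℕ M) ⟨
    q^ (4 *ℕ suc M) ⊗ γ M                         ∎
    where open ≈F-Reasoning

  shiftedPoch4-suc : ∀ M → shiftedPoch4 e (suc M) ≈F (q^ 4 ⊕ xzq^ d) ⊗ q^ (4 *ℕ M) ⊗ poch4 (- 1ℤ) 1 1 d M
  shiftedPoch4-suc zero    = begin
    one ⊗ (q^ 4 ⊕ xzq^ (4 ∸ e))         ≈⟨ FPS.*-identityˡ (q^ 4 ⊕ xzq^ (4 ∸ e)) ⟩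
    q^ 4 ⊕ xzq^ (4 ∸ e)                 ≈⟨ FPS.+-congˡ {q^ 4} (mono-cong 1ℤ 1 1 4∸e≡d) ⟩
    q^ 4 ⊕ xzq^ d                       ≈⟨ FPS.*-identityʳ (q^ 4 ⊕ xzq^ d) ⟨
    (q^ 4 ⊕ xzq^ d) ⊗ one               ≈⟨ FPS.*-identityʳ ((q^ 4 ⊕ xzq^ d) ⊗ one) ⟨
    (q^ 4 ⊕ xzq^ d) ⊗ one ⊗ one         ∎
    where
    open ≈F-Reasoning
    4∸e≡d : 4 ∸ e ≡ d
    4∸e≡d = ≡.trans (≡.cong (_∸ e) (≡.sym e+d≡4)) (ℕ.m+n∸m≡n e d)
  shiftedPoch4-suc (suc M) = begin
    shiftedPoch4 e (suc M) ⊗ (q^ 4 ⊕ xzq^ (4 *ℕ suc M +ℕ 4 ∸ e))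
      ≈⟨ FPS.*-congʳ {q^ 4 ⊕ xzq^ (4 *ℕ suc M +ℕ 4 ∸ e)} (shiftedPoch4-suc M) ⟩
    (q^ 4 ⊕ xzq^ d) ⊗ q^ (4 *ℕ M) ⊗ poch4 (- 1ℤ) 1 1 d M ⊗ (q^ 4 ⊕ xzq^ (4 *ℕ suc M +ℕ 4 ∸ e))
      ≈⟨ shiftedProduct-step (q^ 4 ⊕ xzq^ d) (q^ (4 *ℕ M)) (q^ (4 *ℕ suc M)) (q^ 4) (xzq^ (4 *ℕ suc M +ℕ 4 ∸ e)) (γ M)
           (poch4 (- 1ℤ) 1 1 d M) (q^⊗q^4 M) (q^⊗xzq^ M) ⟩
    (q^ 4 ⊕ xzq^ d) ⊗ q^ (4 *ℕ suc M) ⊗ (poch4 (- 1ℤ) 1 1 d M ⊗ (one ⊕ γ M))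
      ≈⟨ FPS.*-congˡ {(q^ 4 ⊕ xzq^ d) ⊗ q^ (4 *ℕ suc M)} (FPS.*-congˡ {poch4 (- 1ℤ) 1 1 d M}
           (FPS.sym (one⊖neg-mono 1 1 (d +ℕ 4 *ℕ M)))) ⟩
    (q^ 4 ⊕ xzq^ d) ⊗ q^ (4 *ℕ suc M) ⊗ poch4 (- 1ℤ) 1 1 d (suc M)
      ∎
    where open ≈F-Reasoning

  module _ (M : ℕ) where

    open ≈F-Reasoning

    private
      A C P Iα Iβ : FPS
      A  = poch4 (- 1ℤ) 1 1 d M
      C  = invPoch4 1ℤ 0 2 2 (suc M)
      P  = invPoch4 1ℤ 0 0 4 M
      Iα = inv1m (α M)
      Iβ = inv1m (β M)

      invPoch4-z-suc : invPoch4 1ℤ 0 2 2 (suc (suc M)) ≈F C ⊗ Iα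
      invPoch4-z-suc = FPS.refl

      invPoch4-q-suc : invPoch4 1ℤ 0 0 4 (suc M) ≈F P ⊗ Iβ
      invPoch4-q-suc = FPS.refl

      poch4-suc : poch4 (- 1ℤ) 1 1 d (suc M) ≈F A ⊗ (one ⊕ γ M)
      poch4-suc = FPS.*-congˡ {A} (one⊖neg-mono 1 1 (d +ℕ 4 *ℕ M))

      shiftedPoch4-suc-split : shiftedPoch4 e (suc M) ≈F (β M ⊕ γ M) ⊗ A
      shiftedPoch4-suc-split = begin
        shiftedPoch4 e (suc M)
          ≈⟨ shiftedPoch4-suc M ⟩
        (q^ 4 ⊕ xzq^ d) ⊗ q^ (4 *ℕ M) ⊗ A
          ≈⟨ FPS.*-congʳ {A} (FPS.distribʳ (q^ (4 *ℕ M)) (q^ 4) (xzq^ d)) ⟩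
        (q^ 4 ⊗ q^ (4 *ℕ M) ⊕ xzq^ d ⊗ q^ (4 *ℕ M)) ⊗ A
          ≈⟨ FPS.*-congʳ {A} (FPS.+-cong (mono⊗mono 0 0 4 0 0 (4 *ℕ M)) (mono⊗mono 1 1 d 0 0 (4 *ℕ M))) ⟩
        (β M ⊕ γ M) ⊗ A
          ∎

      α-leading : mono 1ℤ 0 2 (4 *ℕ suc M +ℕ 2) ⊗ poch4 (- 1ℤ) 1 1 d (suc M) ≈F α M ⊗ (A ⊗ (one ⊕ γ M))
      α-leading = FPS.*-cong (mono-cong 1ℤ 0 2 (ℕ.+-comm (4 *ℕ suc M) 2)) poch4-suc

    term₁-suc : term₁ (suc M) ≈F (β M ⊕ γ M) ⊗ A ⊗ C ⊗ (P ⊗ Iβ)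
    term₁-suc = FPS.*-cong (FPS.*-congʳ {C} shiftedPoch4-suc-split) invPoch4-q-suc

    term₂-suc : term₂ (suc M) ≈F α M ⊗ (A ⊗ (one ⊕ γ M)) ⊗ (C ⊗ Iα) ⊗ (P ⊗ Iβ)
    term₂-suc = FPS.*-cong (FPS.*-cong α-leading invPoch4-z-suc) invPoch4-q-suc

    partialProduct-suc : partialProduct (suc M) ≈F A ⊗ (one ⊕ γ M) ⊗ (C ⊗ Iα) ⊗ (P ⊗ Iβ)
    partialProduct-suc = FPS.*-cong (FPS.*-cong poch4-suc invPoch4-z-suc) invPoch4-q-suc

    partialSum-step : partialProduct M ⊕ (term₁ (suc M) ⊕ term₂ (suc M)) ≈F partialProduct (suc M)
    partialSum-step = begin
      A ⊗ C ⊗ P ⊕ (term₁ (suc M) ⊕ term₂ (suc M))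
        ≈⟨ FPS.+-congˡ {A ⊗ C ⊗ P} (FPS.+-cong term₁-suc term₂-suc) ⟩
      A ⊗ C ⊗ P ⊕ ((β M ⊕ γ M) ⊗ A ⊗ C ⊗ (P ⊗ Iβ) ⊕ α M ⊗ (A ⊗ (one ⊕ γ M)) ⊗ (C ⊗ Iα) ⊗ (P ⊗ Iβ))
        ≈⟨ partialProduct-step A C P (α M) (β M) (γ M) Iα Iβ
             (inv1m-unfold 0 2 (2 +ℕ 4 *ℕ suc M) (s≤s z≤n)) (inv1m-unfold 0 0 (4 +ℕ 4 *ℕ M) (s≤s z≤n)) ⟩
      A ⊗ (one ⊕ γ M) ⊗ (C ⊗ Iα) ⊗ (P ⊗ Iβ)
        ≈⟨ partialProduct-suc ⟨
      partialProduct (suc M) ∎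

  partialSum : ∀ M → ∑F (suc M) (λ n → term₁ n ⊕ term₂ n) ≈F partialProduct M
  partialSum zero = begin
    ∑F 1 (λ n → term₁ n ⊕ term₂ n)   ≈⟨ FPS.+-identityˡ (term₁ 0 ⊕ term₂ 0) ⟩
    term₁ 0 ⊕ term₂ 0                ≈⟨ FPS.+-cong term₁-zero term₂-zero ⟩
    one ⊕ z²q² ⊗ I                   ≈⟨ inv1m-unfold 0 2 2 (s≤s z≤n) ⟨
    I                                ≈⟨ partialProduct-zero ⟨
    partialProduct 0                 ∎
    where
    open ≈F-Reasoning
    z²q² = mono 1ℤ 0 2 2
    I    = inv1m z²q²

    term₁-zero : term₁ 0 ≈F one
    term₁-zero = FPS.trans (FPS.*-identityʳ (shiftedPoch4 e 0 ⊗ invPoch4 1ℤ 0 2 2 0))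
                           (FPS.*-identityʳ (shiftedPoch4 e 0))

    term₂-zero : term₂ 0 ≈F z²q² ⊗ I
    term₂-zero = FPS.trans (FPS.*-identityʳ (mono 1ℤ 0 2 (4 *ℕ 0 +ℕ 2) ⊗ poch4 (- 1ℤ) 1 1 d 0 ⊗ invPoch4 1ℤ 0 2 2 1))
                 (FPS.trans (FPS.*-congʳ {invPoch4 1ℤ 0 2 2 1} (FPS.*-identityʳ z²q²))
                            (FPS.*-congˡ {z²q²} (FPS.*-identityˡ I)))

    partialProduct-zero : partialProduct 0 ≈F I
    partialProduct-zero = FPS.trans (FPS.*-identityʳ (poch4 (- 1ℤ) 1 1 d 0 ⊗ invPoch4 1ℤ 0 2 2 1))
                          (FPS.trans (FPS.*-identityˡ (invPoch4 1ℤ 0 2 2 1)) (FPS.*-identityˡ I))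
  partialSum (suc M) = FPS.trans (FPS.+-congʳ {term₁ (suc M) ⊕ term₂ (suc M)} (partialSum M)) (partialSum-step M)

  k<D+4k : ∀ D k → 1 ≤ D → k < D +ℕ 4 *ℕ k
  k<D+4k D k 1≤D = ℕ.<-≤-trans (s≤s (ℕ.m≤n*m k 4)) (ℕ.+-monoˡ-≤ (4 *ℕ k) 1≤D)

  truncatedProduct≈[]productSide : ∀ N a b c → N ≤ a → N ≤ b → N ≤ c →
    poch4 (- 1ℤ) 1 1 d a ⊗ invPoch4 1ℤ 0 2 2 b ⊗ invPoch4 1ℤ 0 0 4 c ≈[ N ] productSide
  truncatedProduct≈[]productSide N a b c N≤a N≤b N≤c =
    ⊗-cong≤ (⊗-cong≤ (≈[]-sym (prodInf≈[]prodFin (λ k → one ⊖ mono (- 1ℤ) 1 1 (d +ℕ 4 *ℕ k))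
                                (λ k → one⊖mono≈[]one (- 1ℤ) 1 1 (d +ℕ 4 *ℕ k) k (k<D+4k d k 1≤d)) N a N≤a))
                     (≈[]-sym (prodInf≈[]prodFin (λ k → inv1m (mono 1ℤ 0 2 (2 +ℕ 4 *ℕ k)))
                                (λ k → inv1m≈[]one 0 2 (2 +ℕ 4 *ℕ k) k (k<D+4k 2 k (s≤s z≤n))) N b N≤b)))
            (≈[]-sym (prodInf≈[]prodFin (λ k → inv1m (mono 1ℤ 0 0 (4 +ℕ 4 *ℕ k)))
                       (λ k → inv1m≈[]one 0 0 (4 +ℕ 4 *ℕ k) k (k<D+4k 4 k (s≤s z≤n))) N c N≤c))

  sumSide≡productSide : ∀ i j N → sumSide i j N ≡ productSide i j N
  sumSide≡productSide i j N = ≡.trans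
    (≡.sym (sumTo-distrib-+ (suc N) (λ n → term₁ n i j N) (λ n → term₂ n i j N)))
    (≡.trans (coeff (partialSum N) i j N)
             (coeff≤ (truncatedProduct≈[]productSide N N (suc N) N ≤-refl (ℕ.n≤1+n N) ≤-refl) i j N ≤-refl))

  blockProduct≡sumSide : ∀ i j N →
    prodFin (λ k → (one ⊖ mono (- 1ℤ) 1 1 (d +ℕ 4 *ℕ k)) ⊗ inv1m (mono 1ℤ 0 2 (2 +ℕ 4 *ℕ k))
                   ⊗ inv1m (mono 1ℤ 0 0 (4 +ℕ 4 *ℕ k))) N i j N
      ≡ sumSide i j N
  blockProduct≡sumSide i j N = ≡.trans
    (coeff (prodFin-⊗³ (λ k → one ⊖ mono (- 1ℤ) 1 1 (d +ℕ 4 *ℕ k)) (λ k → inv1m (mono 1ℤ 0 2 (2 +ℕ 4 *ℕ k)))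
                       (λ k → inv1m (mono 1ℤ 0 0 (4 +ℕ 4 *ℕ k))) N) i j N)
    (≡.trans (coeff≤ (truncatedProduct≈[]productSide N N N N ≤-refl ≤-refl ≤-refl) i j N ≤-refl)
             (≡.sym (sumSide≡productSide i j N)))

module Parity where

  open import Data.Bool using (Bool; true; false)
  open import Data.Nat using (⌊_/2⌋; _%_)
  open import Data.Nat.DivMod using ([m+kn]%n≡m%n)
  open import Data.Nat.Divisibility using (_∣_; divides; ∣m+n∣m⇒∣n)
  open import Data.Nat.Solver using (module +-*-Solver)
  open +-*-Solver using (solve; _:=_; _:+_; _:*_; con)

  bit : Bool → ℕ
  bit false = 0
  bit true  = 1

  parity : ℕ → Bool
  parity zero          = false
  parity (suc zero)    = true
  parity (suc (suc n)) = parity n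

  2⌊n/2⌋+parity : ∀ n → 2 *ℕ ⌊ n /2⌋ +ℕ bit (parity n) ≡ n
  2⌊n/2⌋+parity zero          = ≡.refl
  2⌊n/2⌋+parity (suc zero)    = ≡.refl
  2⌊n/2⌋+parity (suc (suc n)) = ≡.trans (≡.cong (_+ℕ bit (parity n)) (ℕ.*-suc 2 ⌊ n /2⌋))
                                        (≡.cong (suc ∘ suc) (2⌊n/2⌋+parity n))

  ⌊2x+ε/2⌋ : ∀ x ε → ⌊ 2 *ℕ x +ℕ bit ε /2⌋ ≡ x
  ⌊2x+ε/2⌋ zero    false = ≡.refl
  ⌊2x+ε/2⌋ zero    true  = ≡.refl
  ⌊2x+ε/2⌋ (suc x) ε     = ≡.trans (≡.cong (λ y → ⌊ y +ℕ bit ε /2⌋) (ℕ.*-suc 2 x)) (≡.cong suc (⌊2x+ε/2⌋ x ε))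

  parity-2x+ε : ∀ x ε → parity (2 *ℕ x +ℕ bit ε) ≡ ε
  parity-2x+ε zero    false = ≡.refl
  parity-2x+ε zero    true  = ≡.refl
  parity-2x+ε (suc x) ε     = ≡.trans (≡.cong (λ y → parity (y +ℕ bit ε)) (ℕ.*-suc 2 x)) (parity-2x+ε x ε)

  n%2≡parity : ∀ n → n % 2 ≡ bit (parity n)
  n%2≡parity zero          = ≡.refl
  n%2≡parity (suc zero)    = ≡.refl
  n%2≡parity (suc (suc n)) = ≡.trans (≡.cong (_% 2) (ℕ.+-comm 2 n)) (≡.trans ([m+kn]%n≡m%n n 1 2) (n%2≡parity n))

  [2x+ε]%2 : ∀ x ε → (2 *ℕ x +ℕ bit ε) % 2 ≡ bit ε
  [2x+ε]%2 x ε = ≡.trans (n%2≡parity (2 *ℕ x +ℕ bit ε)) (≡.cong bit (parity-2x+ε x ε))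

  even⇒parity≡false : ∀ {n} → 2 ∣ n → parity n ≡ false
  even⇒parity≡false (divides q ≡.refl) = parity-q*2 q
    where
    parity-q*2 : ∀ q → parity (q *ℕ 2) ≡ false
    parity-q*2 zero    = ≡.refl
    parity-q*2 (suc q) = parity-q*2 q

  ⌊2x/2⌋ : ∀ x → ⌊ 2 *ℕ x /2⌋ ≡ x
  ⌊2x/2⌋ x = ≡.trans (≡.cong ⌊_/2⌋ (≡.sym (ℕ.+-identityʳ (2 *ℕ x)))) (⌊2x+ε/2⌋ x false)

  [2x]%2 : ∀ x → (2 *ℕ x) % 2 ≡ 0
  [2x]%2 x = ≡.trans (≡.cong (_% 2) (≡.sym (ℕ.+-identityʳ (2 *ℕ x)))) ([2x+ε]%2 x false)

  2∣2* : ∀ x → 2 ∣ 2 *ℕ x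
  2∣2* x = divides x (ℕ.*-comm 2 x)

  2⌊n/2⌋≡n : ∀ {n} → 2 ∣ n → 2 *ℕ ⌊ n /2⌋ ≡ n
  2⌊n/2⌋≡n {n} 2∣n = ≡.trans (≡.sym (ℕ.+-identityʳ _))
    (≡.trans (≡.cong (λ ε → 2 *ℕ ⌊ n /2⌋ +ℕ bit ε) (≡.sym (even⇒parity≡false 2∣n))) (2⌊n/2⌋+parity n))

  2∣∸ : ∀ {t x} → 2 ∣ t → 2 ∣ x → 2 ∣ x ∸ t
  2∣∸ {t} {x} 2∣t 2∣x with ℕ.≤-total t x
  ... | inj₁ t≤x = ∣m+n∣m⇒∣n (≡.subst (2 ∣_) (≡.sym (ℕ.m+[n∸m]≡n t≤x)) 2∣x) 2∣t
  ... | inj₂ x≤t = ≡.subst (2 ∣_) (≡.sym (ℕ.m≤n⇒m∸n≡0 x≤t)) (divides 0 ≡.refl)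

  2[x+ε]≡[2x+ε]+ε : ∀ x ε → 2 *ℕ (x +ℕ bit ε) ≡ 2 *ℕ x +ℕ bit ε +ℕ bit ε
  2[x+ε]≡[2x+ε]+ε x ε = solve 2 (λ x e → con 2 :* (x :+ e) := con 2 :* x :+ e :+ e) ≡.refl x (bit ε)

  2x+ε≤2y⇒x+ε≤y : ∀ x y ε → 2 *ℕ x +ℕ bit ε ≤ 2 *ℕ y → x +ℕ bit ε ≤ y
  2x+ε≤2y⇒x+ε≤y zero    y       false _ = z≤n
  2x+ε≤2y⇒x+ε≤y zero    zero    true  ()
  2x+ε≤2y⇒x+ε≤y zero    (suc y) true  _ = s≤s z≤n
  2x+ε≤2y⇒x+ε≤y (suc x) zero    ε     ()
  2x+ε≤2y⇒x+ε≤y (suc x) (suc y) ε     le = s≤s (2x+ε≤2y⇒x+ε≤y x y ε (≤-pred (≤-pred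
    (≡.subst₂ _≤_ (≡.cong (_+ℕ bit ε) (ℕ.*-suc 2 x)) (ℕ.*-suc 2 y) le))))

module Counting where

  open TrivariateSeries using (_≈F_; coeff; sumTo-cong; module FPS)
  open Monomials using (pow-mono; one⊖neg-mono)
  open Parity using (bit)
  open import Data.Bool using (Bool; true; false)
  open import Data.Empty using (⊥-elim)
  open import Data.Integer using (ℤ; +_; _+_; _*_; -_; 1ℤ)
  import Data.Integer.Properties as ℤ
  open import Data.List using (List; []; _∷_; _++_; map; length; cartesianProduct)
  import Data.List.Properties as List
  open import Data.List.Membership.Propositional using (_∈_)
  import Data.List.Membership.Propositional.Properties as ∈
  open import Data.List.Relation.Unary.All as All using (All; []; _∷_)
  open import Data.List.Relation.Unary.Any using (here)
  open import Data.List.Relation.Unary.Unique.Propositional using (Unique; []; _∷_)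
  import Data.List.Relation.Unary.Unique.Propositional.Properties as Unique
  open import Data.Product using (Σ; ∃-syntax)
  open import Data.Unit using (⊤; tt)
  open import Function.Bundles using (_⇔_; mk⇔; Equivalence)
  open import Relation.Nullary using (¬_; yes; no)
  import Data.Nat

  Weight : Set
  Weight = ℕ × ℕ × ℕ

  infixl 6 _+ʷ_

  _+ʷ_ : Weight → Weight → Weight
  (a , b , c) +ʷ (a′ , b′ , c′) = (a +ℕ a′ , b +ℕ b′ , c +ℕ c′)

  HasCount : {A : Set} → (A → Set) → ℤ → Set
  HasCount {A} Q c = Σ (List A) λ L → Unique L × (∀ a → (a ∈ L) ⇔ Q a) × + length L ≡ c

  GenFun : {A : Set} → (A → Set) → (A → Weight) → FPS → Set
  GenFun P w f = ∀ i j N → HasCount (λ a → P a × w a ≡ (i , j , N)) (f i j N)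

  GenFun-cong : ∀ {A} {P : A → Set} {w f g} → GenFun P w f → f ≈F g → GenFun P w g
  GenFun-cong genF f≈g i j N with genF i j N
  ... | L , unique , members , count = L , unique , members , ≡.trans count (coeff f≈g i j N)

  unique-map : ∀ {A B : Set} {R : A → Set} (f : A → B) {xs : List A} → All R xs →
    (∀ {x y} → R x → R y → f x ≡ f y → x ≡ y) → Unique xs → Unique (map f xs)
  unique-map f []         f-inj []             = []
  unique-map f (rx ∷ rxs) f-inj (x∉xs ∷ unique) = distinct rxs x∉xs ∷ unique-map f rxs f-inj unique
    where
    distinct : ∀ {ys} → All _ ys → All (_ ≢_) ys → All (f _ ≢_) (map f ys)
    distinct []         []           = []
    distinct (ry ∷ rys) (x≢y ∷ x≢ys) = (λ fx≡fy → x≢y (f-inj rx ry fx≡fy)) ∷ distinct rys x≢ys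

  HasCount-transport : ∀ {A B : Set} {QA : A → Set} {QB : B → Set} {c} (to : A → B) (from : B → A) →
    (∀ a → QA a → QB (to a)) → (∀ b → QB b → QA (from b)) →
    (∀ a → QA a → from (to a) ≡ a) → (∀ b → QB b → to (from b) ≡ b) →
    HasCount QB c → HasCount QA c
  HasCount-transport {QA = QA} to from toQ fromQ from∘to to∘from (L , unique , members , count) =
    map from L ,
    unique-map from (All.tabulate (Equivalence.to (members _)))
      (λ {x} {y} qx qy fx≡fy → ≡.trans (≡.sym (to∘from x qx)) (≡.trans (≡.cong to fx≡fy) (to∘from y qy))) unique ,
    (λ a → mk⇔ (member⇒QA a) (λ qa → ≡.subst (_∈ map from L) (from∘to a qa)
                                        (∈.∈-map⁺ from (Equivalence.from (members (to a)) (toQ a qa))))) ,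
    ≡.trans (≡.cong +_ (List.length-map from L)) count
    where
    member⇒QA : ∀ a → a ∈ map from L → QA a
    member⇒QA a a∈ with ∈.∈-map⁻ from a∈
    ... | b , b∈L , ≡.refl = fromQ b (Equivalence.to (members b) b∈L)

  GenFun-transport : ∀ {A B : Set} {PA : A → Set} {PB : B → Set} {wA : A → Weight} {wB : B → Weight} {f}
    (to : A → B) (from : B → A) →
    (∀ a → PA a → PB (to a)) → (∀ b → PB b → PA (from b)) → (∀ b → PB b → wA (from b) ≡ wB b) →
    (∀ a → PA a → from (to a) ≡ a) → (∀ b → PB b → to (from b) ≡ b) →
    GenFun PB wB f → GenFun PA wA f
  GenFun-transport {wA = wA} to from toP fromP weight from∘to to∘from genF i j N =
    HasCount-transport to from
      (λ a (pa , wa) → toP a pa , ≡.trans (≡.sym (weight (to a) (toP a pa))) (≡.trans (≡.cong wA (from∘to a pa)) wa))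
      (λ b (pb , wb) → fromP b pb , ≡.trans (weight b pb) wb)
      (λ a (pa , _) → from∘to a pa) (λ b (pb , _) → to∘from b pb) (genF i j N)

  concatTo : ∀ {X : Set} → ℕ → (ℕ → List X) → List X
  concatTo zero    F = []
  concatTo (suc n) F = concatTo n F ++ F n

  length-concatTo : ∀ {X : Set} n (F : ℕ → List X) → + length (concatTo n F) ≡ sumTo n (λ k → + length (F k))
  length-concatTo zero    F = ≡.refl
  length-concatTo (suc n) F = ≡.trans (≡.cong +_ (List.length-++ (concatTo n F)))
                                      (≡.cong (_+ + length (F n)) (length-concatTo n F))

  ∈-concatTo⁻ : ∀ {X : Set} n (F : ℕ → List X) {x} → x ∈ concatTo n F → ∃[ k ] (k < n × x ∈ F k)
  ∈-concatTo⁻ (suc n) F x∈ with ∈.∈-++⁻ (concatTo n F) x∈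
  ... | inj₂ x∈Fn = n , ≤-refl , x∈Fn
  ... | inj₁ x∈ᶜ with ∈-concatTo⁻ n F x∈ᶜ
  ...   | k , k<n , x∈Fk = k , m<n⇒m<1+n k<n , x∈Fk

  ∈-concatTo⁺ : ∀ {X : Set} n (F : ℕ → List X) {x} k → k < n → x ∈ F k → x ∈ concatTo n F
  ∈-concatTo⁺ (suc n) F k k<1+n x∈Fk with ℕ.m≤n⇒m<n∨m≡n (≤-pred k<1+n)
  ... | inj₁ k<n    = ∈.∈-++⁺ˡ (∈-concatTo⁺ n F k k<n x∈Fk)
  ... | inj₂ ≡.refl = ∈.∈-++⁺ʳ (concatTo n F) x∈Fk

  concatTo-unique : ∀ {X : Set} n (F : ℕ → List X) (key : X → ℕ) → (∀ k → Unique (F k)) →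
    (∀ k x → x ∈ F k → key x ≡ k) → Unique (concatTo n F)
  concatTo-unique zero    F key unique key≡ = []
  concatTo-unique (suc n) F key unique key≡ = Unique.++⁺ (concatTo-unique n F key unique key≡) (unique n) disjoint
    where
    disjoint : ∀ {x} → ¬ (x ∈ concatTo n F × x ∈ F n)
    disjoint (x∈ᶜ , x∈Fn) with ∈-concatTo⁻ n F x∈ᶜ
    ... | k , k<n , x∈Fk = ℕ.<-irrefl (≡.trans (≡.sym (key≡ k _ x∈Fk)) (key≡ n _ x∈Fn)) k<n

  length-cartesianProduct : ∀ {A B : Set} (xs : List A) (ys : List B) →
    length (cartesianProduct xs ys) ≡ length xs *ℕ length ys
  length-cartesianProduct []       ys = ≡.refl
  length-cartesianProduct (x ∷ xs) ys = ≡.trans (List.length-++ (map (x ,_) ys))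
    (≡.cong₂ _+ℕ_ (List.length-map (x ,_) ys) (length-cartesianProduct xs ys))

  HasCount-empty : ∀ {A : Set} {Q : A → Set} → (∀ a → ¬ Q a) → HasCount Q (+ 0)
  HasCount-empty ¬Q = [] , [] , (λ a → mk⇔ (λ ()) (λ q → ⊥-elim (¬Q a q))) , ≡.refl

  GenFun-unit : ∀ a b d → GenFun {⊤} (λ _ → ⊤) (λ _ → (a , b , d)) (mono 1ℤ a b d)
  GenFun-unit a b d i j N with i Data.Nat.≟ a | j Data.Nat.≟ b | N Data.Nat.≟ d
  ... | yes ≡.refl | yes ≡.refl | yes ≡.refl =
    tt ∷ [] , [] ∷ [] , (λ _ → mk⇔ (λ _ → tt , ≡.refl) (λ _ → here ≡.refl)) , ≡.refl
  ... | yes ≡.refl | yes ≡.refl | no N≢d = HasCount-empty (λ _ (_ , w≡) → N≢d (≡.sym (≡.cong (proj₂ ∘ proj₂) w≡)))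
  ... | yes ≡.refl | no j≢b     | _      = HasCount-empty (λ _ (_ , w≡) → j≢b (≡.sym (≡.cong (proj₁ ∘ proj₂) w≡)))
  ... | no i≢a     | _          | _      = HasCount-empty (λ _ (_ , w≡) → i≢a (≡.sym (≡.cong proj₁ w≡)))

  GenFun-⊎ : ∀ {A B : Set} {PA : A → Set} {PB : B → Set} {wA : A → Weight} {wB : B → Weight} {f g} →
    GenFun PA wA f → GenFun PB wB g → GenFun (either PA PB) (either wA wB) (f ⊕ g)
  GenFun-⊎ {A} {B} {PA} {PB} {wA} {wB} genF genG i j N =
    map inj₁ LA ++ map inj₂ LB ,
    Unique.++⁺ (Unique.map⁺ inj₁-injective (proj₁ (proj₂ (genF i j N))))
               (Unique.map⁺ inj₂-injective (proj₁ (proj₂ (genG i j N)))) disjoint ,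
    members ,
    ≡.trans (≡.cong +_ (≡.trans (List.length-++ (map inj₁ LA))
                                (≡.cong₂ _+ℕ_ (List.length-map inj₁ LA) (List.length-map inj₂ LB))))
            (≡.cong₂ _+_ (proj₂ (proj₂ (proj₂ (genF i j N)))) (proj₂ (proj₂ (proj₂ (genG i j N)))))
    where
    LA = proj₁ (genF i j N)
    LB = proj₁ (genG i j N)
    membersA = proj₁ (proj₂ (proj₂ (genF i j N)))
    membersB = proj₁ (proj₂ (proj₂ (genG i j N)))

    disjoint : ∀ {v} → ¬ (v ∈ map inj₁ LA × v ∈ map inj₂ LB)
    disjoint (v∈₁ , v∈₂) with ∈.∈-map⁻ inj₁ v∈₁ | ∈.∈-map⁻ inj₂ v∈₂
    ... | _ , _ , ≡.refl | _ , _ , ()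

    members : ∀ v → (v ∈ map inj₁ LA ++ map inj₂ LB) ⇔ (either PA PB v × either wA wB v ≡ (i , j , N))
    members (inj₁ x) = mk⇔ member⇒ (λ q → ∈.∈-++⁺ˡ (∈.∈-map⁺ inj₁ (Equivalence.from (membersA x) q)))
      where
      member⇒ : inj₁ x ∈ map inj₁ LA ++ map inj₂ LB → PA x × wA x ≡ (i , j , N)
      member⇒ x∈ with ∈.∈-++⁻ (map inj₁ LA) x∈
      ... | inj₁ x∈₁ with ∈.∈-map⁻ inj₁ x∈₁
      ...   | _ , x∈LA , ≡.refl = Equivalence.to (membersA x) x∈LA
      member⇒ x∈ | inj₂ x∈₂ with ∈.∈-map⁻ inj₂ x∈₂
      ...   | _ , _ , ()
    members (inj₂ y) = mk⇔ member⇒ (λ q → ∈.∈-++⁺ʳ (map inj₁ LA) (∈.∈-map⁺ inj₂ (Equivalence.from (membersB y) q)))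
      where
      member⇒ : inj₂ y ∈ map inj₁ LA ++ map inj₂ LB → PB y × wB y ≡ (i , j , N)
      member⇒ y∈ with ∈.∈-++⁻ (map inj₁ LA) y∈
      ... | inj₂ y∈₂ with ∈.∈-map⁻ inj₂ y∈₂
      ...   | _ , y∈LB , ≡.refl = Equivalence.to (membersB y) y∈LB
      member⇒ y∈ | inj₁ y∈₁ with ∈.∈-map⁻ inj₁ y∈₁
      ...   | _ , _ , ()

  concatTo³ : ∀ {X : Set} → ℕ → ℕ → ℕ → (ℕ → ℕ → ℕ → List X) → List X
  concatTo³ i j N F = concatTo (suc i) λ a → concatTo (suc j) λ b → concatTo (suc N) (F a b)

  length-concatTo³ : ∀ {X : Set} i j N (F : ℕ → ℕ → ℕ → List X) →
    + length (concatTo³ i j N F) ≡ sumTo (suc i) λ a → sumTo (suc j) λ b → sumTo (suc N) λ c → + length (F a b c)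
  length-concatTo³ i j N F =
    ≡.trans (length-concatTo (suc i) _) (sumTo-cong (suc i) λ a →
    ≡.trans (length-concatTo (suc j) _) (sumTo-cong (suc j) λ b → length-concatTo (suc N) (F a b)))

  ∈-concatTo³⁻ : ∀ {X : Set} i j N (F : ℕ → ℕ → ℕ → List X) {x} → x ∈ concatTo³ i j N F →
    ∃[ a ] ∃[ b ] ∃[ c ] (a ≤ i × b ≤ j × c ≤ N × x ∈ F a b c)
  ∈-concatTo³⁻ i j N F x∈ with ∈-concatTo⁻ (suc i) _ x∈
  ... | a , a<1+i , x∈ᵃ with ∈-concatTo⁻ (suc j) _ x∈ᵃ
  ... | b , b<1+j , x∈ᵇ with ∈-concatTo⁻ (suc N) _ x∈ᵇ
  ... | c , c<1+N , x∈ᶜ = a , b , c , ≤-pred a<1+i , ≤-pred b<1+j , ≤-pred c<1+N , x∈ᶜ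

  ∈-concatTo³⁺ : ∀ {X : Set} i j N (F : ℕ → ℕ → ℕ → List X) {x} a b c → a ≤ i → b ≤ j → c ≤ N →
    x ∈ F a b c → x ∈ concatTo³ i j N F
  ∈-concatTo³⁺ i j N F a b c a≤i b≤j c≤N x∈ =
    ∈-concatTo⁺ (suc i) _ a (s≤s a≤i) (∈-concatTo⁺ (suc j) _ b (s≤s b≤j) (∈-concatTo⁺ (suc N) (F a b) c (s≤s c≤N) x∈))

  concatTo³-unique : ∀ {X : Set} i j N (F : ℕ → ℕ → ℕ → List X) (key : X → Weight) →
    (∀ a b c → Unique (F a b c)) → (∀ a b c x → x ∈ F a b c → key x ≡ (a , b , c)) → Unique (concatTo³ i j N F)
  concatTo³-unique i j N F key unique key≡ =
    concatTo-unique (suc i) _ (proj₁ ∘ key)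
      (λ a → concatTo-unique (suc j) _ (proj₁ ∘ proj₂ ∘ key)
         (λ b → concatTo-unique (suc N) (F a b) (proj₂ ∘ proj₂ ∘ key) (unique a b)
                  (λ c x x∈ → ≡.cong (proj₂ ∘ proj₂) (key≡ a b c x x∈)))
         (λ b x x∈ → let (c , _ , x∈ᶜ) = ∈-concatTo⁻ (suc N) (F a b) x∈ in ≡.cong (proj₁ ∘ proj₂) (key≡ a b c x x∈ᶜ)))
      (λ a x x∈ → let (b , _ , x∈ᵇ) = ∈-concatTo⁻ (suc j) _ x∈
                      (c , _ , x∈ᶜ) = ∈-concatTo⁻ (suc N) (F a b) x∈ᵇ
                  in ≡.cong proj₁ (key≡ a b c x x∈ᶜ))

  m+ʷ[n∸m]≡n : ∀ {a b c i j N} → a ≤ i → b ≤ j → c ≤ N → (a , b , c) +ʷ (i ∸ a , j ∸ b , N ∸ c) ≡ (i , j , N)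
  m+ʷ[n∸m]≡n a≤i b≤j c≤N = ≡.cong₂ _,_ (ℕ.m+[n∸m]≡n a≤i) (≡.cong₂ _,_ (ℕ.m+[n∸m]≡n b≤j) (ℕ.m+[n∸m]≡n c≤N))

  [m+n∸m]ʷ≡n : ∀ a b c a′ b′ c′ → (a +ℕ a′ ∸ a , b +ℕ b′ ∸ b , c +ℕ c′ ∸ c) ≡ (a′ , b′ , c′)
  [m+n∸m]ʷ≡n a b c a′ b′ c′ = ≡.cong₂ _,_ (ℕ.m+n∸m≡n a a′) (≡.cong₂ _,_ (ℕ.m+n∸m≡n b b′) (ℕ.m+n∸m≡n c c′))

  module CauchyProduct {A B : Set} {PA : A → Set} {PB : B → Set} {wA : A → Weight} {wB : B → Weight} {f g : FPS}
    (genF : GenFun PA wA f) (genG : GenFun PB wB g) (i j N : ℕ) where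

    LA : ℕ → ℕ → ℕ → List A
    LA a b c = proj₁ (genF a b c)

    LB : ℕ → ℕ → ℕ → List B
    LB a b c = proj₁ (genG a b c)

    ∈LA⇔ : ∀ {a b c} x → (x ∈ LA a b c) ⇔ (PA x × wA x ≡ (a , b , c))
    ∈LA⇔ {a} {b} {c} = proj₁ (proj₂ (proj₂ (genF a b c)))

    ∈LB⇔ : ∀ {a b c} y → (y ∈ LB a b c) ⇔ (PB y × wB y ≡ (a , b , c))
    ∈LB⇔ {a} {b} {c} = proj₁ (proj₂ (proj₂ (genG a b c)))

    block : ℕ → ℕ → ℕ → List (A × B)
    block a b c = cartesianProduct (LA a b c) (LB (i ∸ a) (j ∸ b) (N ∸ c))

    pairs : List (A × B)
    pairs = concatTo³ i j N block

    length-pairs : + length pairs ≡ (f ⊗ g) i j N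
    length-pairs = ≡.trans (length-concatTo³ i j N block)
      (sumTo-cong (suc i) λ a → sumTo-cong (suc j) λ b → sumTo-cong (suc N) λ c →
        ≡.trans (≡.cong +_ (length-cartesianProduct (LA a b c) (LB (i ∸ a) (j ∸ b) (N ∸ c))))
        (≡.trans (ℤ.pos-* (length (LA a b c)) (length (LB (i ∸ a) (j ∸ b) (N ∸ c))))
                 (≡.cong₂ _*_ (proj₂ (proj₂ (proj₂ (genF a b c))))
                              (proj₂ (proj₂ (proj₂ (genG (i ∸ a) (j ∸ b) (N ∸ c))))))))

    pairs-unique : Unique pairs
    pairs-unique = concatTo³-unique i j N block (wA ∘ proj₁)
      (λ a b c → Unique.cartesianProduct⁺ (proj₁ (proj₂ (genF a b c))) (proj₁ (proj₂ (genG (i ∸ a) (j ∸ b) (N ∸ c)))))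
      (λ a b c (x , y) xy∈ → proj₂ (Equivalence.to (∈LA⇔ x) (proj₁ (∈.∈-cartesianProduct⁻ (LA a b c) _ xy∈))))

    ∈pairs⇒ : ∀ {x y} → (x , y) ∈ pairs → (PA x × PB y) × wA x +ʷ wB y ≡ (i , j , N)
    ∈pairs⇒ {x} {y} xy∈ with ∈-concatTo³⁻ i j N block xy∈
    ... | a , b , c , a≤i , b≤j , c≤N , xy∈blk with ∈.∈-cartesianProduct⁻ (LA a b c) _ xy∈blk
    ... | x∈ , y∈ with Equivalence.to (∈LA⇔ x) x∈ | Equivalence.to (∈LB⇔ y) y∈
    ... | pa , wx≡ | pb , wy≡ = (pa , pb) , ≡.trans (≡.cong₂ _+ʷ_ wx≡ wy≡) (m+ʷ[n∸m]≡n a≤i b≤j c≤N)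

    ⇒∈pairs : ∀ {x y} → (PA x × PB y) × wA x +ʷ wB y ≡ (i , j , N) → (x , y) ∈ pairs
    ⇒∈pairs {x} {y} ((pa , pb) , w≡) with wA x in wx≡ | wB y in wy≡
    ... | (a , b , c) | (a′ , b′ , c′) with w≡
    ... | ≡.refl = ∈-concatTo³⁺ (a +ℕ a′) (b +ℕ b′) (c +ℕ c′) block a b c
                     (ℕ.m≤m+n a a′) (ℕ.m≤m+n b b′) (ℕ.m≤m+n c c′)
                     (∈.∈-cartesianProduct⁺ (Equivalence.from (∈LA⇔ x) (pa , wx≡))
                       (Equivalence.from (∈LB⇔ y) (pb , ≡.trans wy≡ (≡.sym ([m+n∸m]ʷ≡n a b c a′ b′ c′)))))

  GenFun-× : ∀ {A B : Set} {PA : A → Set} {PB : B → Set} {wA : A → Weight} {wB : B → Weight} {f g} →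
    GenFun PA wA f → GenFun PB wB g →
    GenFun (λ (p : A × B) → PA (proj₁ p) × PB (proj₂ p)) (λ p → wA (proj₁ p) +ʷ wB (proj₂ p)) (f ⊗ g)
  GenFun-× genF genG i j N = pairs , pairs-unique , (λ _ → mk⇔ ∈pairs⇒ ⇒∈pairs) , length-pairs
    where open CauchyProduct genF genG i j N

  GenFun-ℕ : ∀ a b D → 1 ≤ D → GenFun {ℕ} (λ _ → ⊤) (λ n → (n *ℕ a , n *ℕ b , n *ℕ D)) (inv1m (mono 1ℤ a b D))
  GenFun-ℕ a b D 1≤D i j N = concatTo (suc N) block , unique , members , count
    where
    unitᶜ : ∀ n → HasCount (λ (_ : ⊤) → ⊤ × (n *ℕ a , n *ℕ b , n *ℕ D) ≡ (i , j , N))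
                           (mono 1ℤ (n *ℕ a) (n *ℕ b) (n *ℕ D) i j N)
    unitᶜ n = GenFun-unit (n *ℕ a) (n *ℕ b) (n *ℕ D) i j N

    block : ℕ → List ℕ
    block n = map (λ _ → n) (proj₁ (unitᶜ n))

    ∈block : ∀ {n m} → m ∈ block n → m ≡ n
    ∈block {n} m∈ = proj₂ (proj₂ (∈.∈-map⁻ (λ _ → n) m∈))

    count : + length (concatTo (suc N) block) ≡ inv1m (mono 1ℤ a b D) i j N
    count = ≡.trans (length-concatTo (suc N) block) (sumTo-cong (suc N) λ n →
              ≡.trans (≡.cong +_ (List.length-map (λ _ → n) (proj₁ (unitᶜ n))))
              (≡.trans (proj₂ (proj₂ (proj₂ (unitᶜ n)))) (≡.sym (coeff (pow-mono a b D n) i j N))))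

    unique : Unique (concatTo (suc N) block)
    unique = concatTo-unique (suc N) block (λ n → n) (λ n → Unique.map⁺ (λ _ → ≡.refl) (proj₁ (proj₂ (unitᶜ n))))
               (λ _ _ m∈ → ∈block m∈)

    members : ∀ n → (n ∈ concatTo (suc N) block) ⇔ (⊤ × (n *ℕ a , n *ℕ b , n *ℕ D) ≡ (i , j , N))
    members n = mk⇔ member⇒ ⇒member
      where
      member⇒ : n ∈ concatTo (suc N) block → ⊤ × (n *ℕ a , n *ℕ b , n *ℕ D) ≡ (i , j , N)
      member⇒ n∈ with ∈-concatTo⁻ (suc N) block n∈
      ... | k , _ , n∈ᵏ with ∈.∈-map⁻ (λ _ → k) n∈ᵏ
      ... | t , t∈ , ≡.refl = Equivalence.to (proj₁ (proj₂ (proj₂ (unitᶜ n))) t) t∈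

      ⇒member : ⊤ × (n *ℕ a , n *ℕ b , n *ℕ D) ≡ (i , j , N) → n ∈ concatTo (suc N) block
      ⇒member (_ , w≡) = ∈-concatTo⁺ (suc N) block n (s≤s n≤N)
        (∈.∈-map⁺ (λ _ → n) (Equivalence.from (proj₁ (proj₂ (proj₂ (unitᶜ n))) tt) (tt , w≡)))
        where
        n≤N : n ≤ N
        n≤N = ≡.subst (n ≤_) (≡.cong (proj₂ ∘ proj₂) w≡) (ℕ.m≤m*n n D {{>-nonZero 1≤D}})

  GenFun-Bool : ∀ D → GenFun {Bool} (λ _ → ⊤) (λ ε → (bit ε , bit ε , bit ε *ℕ D)) (one ⊖ mono (- 1ℤ) 1 1 D)
  GenFun-Bool D = GenFun-cong
    (GenFun-transport {PB = either (λ _ → ⊤) (λ _ → ⊤)} {wB = either (λ _ → (0 , 0 , 0)) (λ _ → (1 , 1 , D))}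
      toSum fromSum (λ { false _ → tt ; true _ → tt }) (λ _ _ → tt) weight from∘to to∘from
      (GenFun-⊎ (GenFun-unit 0 0 0) (GenFun-unit 1 1 D)))
    (FPS.sym (one⊖neg-mono 1 1 D))
    where
    toSum : Bool → ⊤ ⊎ ⊤
    toSum false = inj₁ tt
    toSum true  = inj₂ tt

    fromSum : ⊤ ⊎ ⊤ → Bool
    fromSum (inj₁ _) = false
    fromSum (inj₂ _) = true

    weight : ∀ u → either (λ _ → ⊤) (λ _ → ⊤) u →
      (bit (fromSum u) , bit (fromSum u) , bit (fromSum u) *ℕ D) ≡ either (λ _ → (0 , 0 , 0)) (λ _ → (1 , 1 , D)) u
    weight (inj₁ _) _ = ≡.refl
    weight (inj₂ _) _ = ≡.cong (λ n → (1 , 1 , n)) (ℕ.+-identityʳ D)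

    from∘to : ∀ ε → ⊤ → fromSum (toSum ε) ≡ ε
    from∘to false _ = ≡.refl
    from∘to true  _ = ≡.refl

    to∘from : ∀ u → either (λ _ → ⊤) (λ _ → ⊤) u → toSum (fromSum u) ≡ u
    to∘from (inj₁ _) _ = ≡.refl
    to∘from (inj₂ _) _ = ≡.refl

module PartitionLists where

  open import Data.Integer using (ℤ; +_; _+_; _-_; -_)
  import Data.Integer.Properties as ℤ
  open import Data.List using (List; []; _∷_; _++_; map; length; replicate)
  import Data.List.Properties as List
  open import Data.List.Relation.Unary.All using (All; []; _∷_)
  open import Data.Nat using (_%_)
  open import Data.Nat.DivMod using ([m+kn]%n≡m%n)
  open import Data.Nat.Divisibility using (_∣_; divides)
  open import Data.Unit using (tt)

  double : ℕ → ℕ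
  double zero    = zero
  double (suc K) = suc (suc (double K))

  suc-injective² : ∀ {m n} → suc (suc m) ≡ suc (suc n) → m ≡ n
  suc-injective² = ℕ.suc-injective ∘ ℕ.suc-injective

  double≡2* : ∀ K → double K ≡ 2 *ℕ K
  double≡2* zero    = ≡.refl
  double≡2* (suc K) = ≡.trans (≡.cong (suc ∘ suc) (double≡2* K)) (≡.sym (ℕ.*-suc 2 K))

  n≤double : ∀ n → n ≤ double n
  n≤double zero    = z≤n
  n≤double (suc n) = s≤s (ℕ.m≤n⇒m≤1+n (n≤double n))

  length-++-pair : ∀ (p : List ℕ) {K} b c → length p ≡ double K → length (p ++ b ∷ c ∷ []) ≡ double (suc K)
  length-++-pair p {K} b c len≡ = ≡.trans (List.length-++ p) (≡.trans (≡.cong (_+ℕ 2) len≡) (ℕ.+-comm (double K) 2))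

  decreasing-tail : ∀ {x r} → Decreasing (x ∷ r) → Decreasing r
  decreasing-tail [ x ]    = []
  decreasing-tail (_ ∷ ds) = ds

  decreasing-++⁻ˡ : ∀ p q → Decreasing (p ++ q) → Decreasing p
  decreasing-++⁻ˡ []           q ds          = []
  decreasing-++⁻ˡ (x ∷ [])     q ds          = [ x ]
  decreasing-++⁻ˡ (x ∷ y ∷ p) q (y≤x ∷ ds) = y≤x ∷ decreasing-++⁻ˡ (y ∷ p) q ds

  decreasing-++⁻ʳ : ∀ p q → Decreasing (p ++ q) → Decreasing q
  decreasing-++⁻ʳ []      q ds = ds
  decreasing-++⁻ʳ (x ∷ p) q ds = decreasing-++⁻ʳ p q (decreasing-tail ds)

  decreasing-++-pair⇒≤ : ∀ p {b c} → Decreasing (p ++ b ∷ c ∷ []) → c ≤ b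
  decreasing-++-pair⇒≤ p ds with decreasing-++⁻ʳ p _ ds
  ... | c≤b ∷ _ = c≤b

  decreasing-++⁺ : ∀ p {b r} → Decreasing p → All (b ≤_) p → Decreasing (b ∷ r) → Decreasing (p ++ b ∷ r)
  decreasing-++⁺ []           ds          b≤p          dbr = dbr
  decreasing-++⁺ (x ∷ [])     ds          (b≤x ∷ [])   dbr = b≤x ∷ dbr
  decreasing-++⁺ (x ∷ y ∷ p) (y≤x ∷ ds) (_ ∷ b≤y∷p) dbr = y≤x ∷ decreasing-++⁺ (y ∷ p) ds b≤y∷p dbr

  decreasing-++⇒≤ : ∀ p {b r} → Decreasing (p ++ b ∷ r) → All (b ≤_) p
  decreasing-++⇒≤ []           ds = []
  decreasing-++⇒≤ (x ∷ [])     (b≤x ∷ _) = b≤x ∷ []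
  decreasing-++⇒≤ (x ∷ y ∷ p) (y≤x ∷ ds) with decreasing-++⇒≤ (y ∷ p) ds
  ... | b≤y ∷ b≤p = ℕ.≤-trans b≤y y≤x ∷ b≤y ∷ b≤p

  decreasing-map-+ : ∀ t {l} → Decreasing l → Decreasing (map (t +ℕ_) l)
  decreasing-map-+ t []         = []
  decreasing-map-+ t [ x ]      = [ t +ℕ x ]
  decreasing-map-+ t (y≤x ∷ ds) = ℕ.+-monoʳ-≤ t y≤x ∷ decreasing-map-+ t ds

  decreasing-map-∸ : ∀ t {l} → Decreasing l → Decreasing (map (_∸ t) l)
  decreasing-map-∸ t []         = []
  decreasing-map-∸ t [ x ]      = [ x ∸ t ]
  decreasing-map-∸ t (y≤x ∷ ds) = ℕ.∸-monoˡ-≤ t y≤x ∷ decreasing-map-∸ t ds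

  map-+-∸ : ∀ t l → All (t ≤_) l → map (t +ℕ_) (map (_∸ t) l) ≡ l
  map-+-∸ t []      []          = ≡.refl
  map-+-∸ t (x ∷ l) (t≤x ∷ t≤l) = ≡.cong₂ _∷_ (ℕ.m+[n∸m]≡n t≤x) (map-+-∸ t l t≤l)

  map-∸-+ : ∀ t l → map (_∸ t) (map (t +ℕ_) l) ≡ l
  map-∸-+ t []      = ≡.refl
  map-∸-+ t (x ∷ l) = ≡.cong₂ _∷_ (ℕ.m+n∸m≡n t x) (map-∸-+ t l)

  ≤-map-+ : ∀ {b t} l → b ≤ t → All (b ≤_) (map (t +ℕ_) l)
  ≤-map-+ []          b≤t = []
  ≤-map-+ {t = t} (x ∷ l) b≤t = ℕ.≤-trans b≤t (ℕ.m≤m+n t x) ∷ ≤-map-+ l b≤t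

  size-++ : ∀ l m → size (l ++ m) ≡ size l +ℕ size m
  size-++ []      m = ≡.refl
  size-++ (x ∷ l) m = ≡.trans (≡.cong (x +ℕ_) (size-++ l m)) (≡.sym (ℕ.+-assoc x (size l) (size m)))

  size-map-+ : ∀ t l → size (map (t +ℕ_) l) ≡ length l *ℕ t +ℕ size l
  size-map-+ t []      = ≡.refl
  size-map-+ t (x ∷ l) = ≡.trans (≡.cong ((t +ℕ x) +ℕ_) (size-map-+ t l))
                                 (solve 4 (λ t x a s → (t :+ x) :+ (a :+ s) := (t :+ a) :+ (x :+ s)) ≡.refl
                                          t x (length l *ℕ t) (size l))
    where open import Data.Nat.Solver using (module +-*-Solver)
          open +-*-Solver using (solve; _:=_; _:+_)

  oddParts-++ : ∀ l m → oddParts (l ++ m) ≡ oddParts l +ℕ oddParts m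
  oddParts-++ []      m = ≡.refl
  oddParts-++ (x ∷ l) m = ≡.trans (≡.cong (x % 2 +ℕ_) (oddParts-++ l m))
                                  (≡.sym (ℕ.+-assoc (x % 2) (oddParts l) (oddParts m)))

  oddParts-map-+ : ∀ t l → 2 ∣ t → oddParts (map (t +ℕ_) l) ≡ oddParts l
  oddParts-map-+ t []      _ = ≡.refl
  oddParts-map-+ .(q *ℕ 2) (x ∷ l) (divides q ≡.refl) =
    ≡.cong₂ _+ℕ_ (≡.trans (≡.cong (_% 2) (ℕ.+-comm (q *ℕ 2) x)) ([m+kn]%n≡m%n x q 2))
                 (oddParts-map-+ (q *ℕ 2) l (divides q ≡.refl))

  altSum-pair : ∀ x y r → altSum (x ∷ y ∷ r) ≡ (+ x - + y) + altSum r
  altSum-pair x y r = ≡.trans (≡.cong (λ z → + x + z) (≡.trans (ℤ.neg-distrib-+ (+ y) (- altSum r))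
    (≡.cong (λ z → - + y + z) (ℤ.neg-involutive (altSum r))))) (≡.sym (ℤ.+-assoc (+ x) (- + y) (altSum r)))

  altSum-++ : ∀ K l m → length l ≡ double K → altSum (l ++ m) ≡ altSum l + altSum m
  altSum-++ zero    []          m _     = ≡.sym (ℤ.+-identityˡ _)
  altSum-++ (suc K) (x ∷ y ∷ l) m len≡ = begin
    altSum (x ∷ y ∷ l ++ m)                 ≡⟨ altSum-pair x y (l ++ m) ⟩
    (+ x - + y) + altSum (l ++ m)           ≡⟨ ≡.cong (λ z → (+ x - + y) + z) (altSum-++ K l m (suc-injective² len≡)) ⟩
    (+ x - + y) + (altSum l + altSum m)     ≡⟨ ℤ.+-assoc (+ x - + y) (altSum l) (altSum m) ⟨
    (+ x - + y) + altSum l + altSum m       ≡⟨ ≡.cong (_+ altSum m) (altSum-pair x y l) ⟨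
    altSum (x ∷ y ∷ l) + altSum m           ∎
    where open ≡.≡-Reasoning

  altSum-map-+ : ∀ K t l → length l ≡ double K → altSum (map (t +ℕ_) l) ≡ altSum l
  altSum-map-+ zero    t []          _     = ≡.refl
  altSum-map-+ (suc K) t (x ∷ y ∷ l) len≡ = begin
    altSum (map (t +ℕ_) (x ∷ y ∷ l))                       ≡⟨ altSum-pair (t +ℕ x) (t +ℕ y) (map (t +ℕ_) l) ⟩
    (+ (t +ℕ x) - + (t +ℕ y)) + altSum (map (t +ℕ_) l)    ≡⟨ ≡.cong₂ _+_ difference
                                                                 (altSum-map-+ K t l (suc-injective² len≡)) ⟩
    (+ x - + y) + altSum l                                 ≡⟨ altSum-pair x y l ⟨
    altSum (x ∷ y ∷ l)                                     ∎
    where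
    open ≡.≡-Reasoning
    difference : + (t +ℕ x) - + (t +ℕ y) ≡ + x - + y
    difference = ≡.trans (ℤ.m-n≡m⊖n (t +ℕ x) (t +ℕ y)) (≡.trans (ℤ.+-cancelˡ-⊖ t x y) (≡.sym (ℤ.m-n≡m⊖n x y)))

  -- On decreasing lists no subtraction below truncates (altSum≡altSumℕ).
  altSumℕ : List ℕ → ℕ
  altSumℕ []       = 0
  altSumℕ (p ∷ ps) = p ∸ altSumℕ ps

  altSumℕ-tail≤head : ∀ {p ps} → Decreasing (p ∷ ps) → altSumℕ ps ≤ p
  altSumℕ-tail≤head [ p ]                 = z≤n
  altSumℕ-tail≤head {ps = q ∷ qs} (q≤p ∷ _) = ℕ.≤-trans (ℕ.m∸n≤m q (altSumℕ qs)) q≤p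

  +m-+n≡+[m∸n] : ∀ {m n} → n ≤ m → + m - + n ≡ + (m ∸ n)
  +m-+n≡+[m∸n] {m} {n} n≤m = ≡.trans (ℤ.m-n≡m⊖n m n) (ℤ.⊖-≥ n≤m)

  altSum≡altSumℕ : ∀ {l} → Decreasing l → altSum l ≡ + altSumℕ l
  altSum≡altSumℕ []                 = ≡.refl
  altSum≡altSumℕ [ p ]              = ≡.cong +_ (ℕ.+-identityʳ p)
  altSum≡altSumℕ {p ∷ _} ds@(_ ∷ ds′) =
    ≡.trans (≡.cong (λ z → + p - z) (altSum≡altSumℕ ds′)) (+m-+n≡+[m∸n] (altSumℕ-tail≤head ds))

  splitLastPair : List ℕ → List ℕ × ℕ × ℕ
  splitLastPair []              = ([] , 0 , 0)
  splitLastPair (x ∷ [])        = ([] , 0 , 0)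
  splitLastPair (x ∷ y ∷ [])    = ([] , x , y)
  splitLastPair (x ∷ y ∷ z ∷ r) = Product.map₁ (x ∷_) (splitLastPair (y ∷ z ∷ r))

  splitLastPair-++ : ∀ p b c → splitLastPair (p ++ b ∷ c ∷ []) ≡ (p , b , c)
  splitLastPair-++ []              b c = ≡.refl
  splitLastPair-++ (x ∷ [])        b c = ≡.refl
  splitLastPair-++ (x ∷ y ∷ [])    b c = ≡.refl
  splitLastPair-++ (x ∷ y ∷ z ∷ p) b c = ≡.cong (Product.map₁ (x ∷_)) (splitLastPair-++ (y ∷ z ∷ p) b c)

  data LastPairView (K : ℕ) : List ℕ → Set where
    _++[_,_] : ∀ p b c → length p ≡ double K → LastPairView K (p ++ b ∷ c ∷ [])

  lastPairView : ∀ K l → length l ≡ double (suc K) → LastPairView K l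
  lastPairView zero    (x ∷ y ∷ [])  _    = ([] ++[ x , y ]) ≡.refl
  lastPairView (suc K) (x ∷ y ∷ l) len≡ with lastPairView K l (suc-injective² len≡)
  ... | (p ++[ b , c ]) len≡′ = ((x ∷ y ∷ p) ++[ b , c ]) (≡.cong (suc ∘ suc) len≡′)

  EvenIndexedEven⇒OddIndexedEven : ∀ y r → EvenIndexedEven (y ∷ r) → OddIndexedEven r
  EvenIndexedEven⇒OddIndexedEven y []      h = h
  EvenIndexedEven⇒OddIndexedEven y (z ∷ r) h = h

  OddIndexedEven⇒EvenIndexedEven : ∀ y r → OddIndexedEven r → EvenIndexedEven (y ∷ r)
  OddIndexedEven⇒EvenIndexedEven y []      h = h
  OddIndexedEven⇒EvenIndexedEven y (z ∷ r) h = h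

  EvenIndexedEven-map : ∀ (f : ℕ → ℕ) → (∀ {x} → 2 ∣ x → 2 ∣ f x) → ∀ l → EvenIndexedEven l → EvenIndexedEven (map f l)
  EvenIndexedEven-map f f-even []          h          = tt
  EvenIndexedEven-map f f-even (x ∷ [])    h          = tt
  EvenIndexedEven-map f f-even (x ∷ y ∷ l) (2∣y , h) = f-even 2∣y , EvenIndexedEven-map f f-even l h

  OddIndexedEven-map : ∀ (f : ℕ → ℕ) → (∀ {x} → 2 ∣ x → 2 ∣ f x) → ∀ l → OddIndexedEven l → OddIndexedEven (map f l)
  OddIndexedEven-map f f-even []      h          = tt
  OddIndexedEven-map f f-even (x ∷ l) (2∣x , h) = f-even 2∣x , EvenIndexedEven-map f f-even l h

  EvenIndexedEven-++⁻ˡ : ∀ p q → EvenIndexedEven (p ++ q) → EvenIndexedEven p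
  EvenIndexedEven-++⁻ˡ []          q h          = tt
  EvenIndexedEven-++⁻ˡ (x ∷ [])    q h          = tt
  EvenIndexedEven-++⁻ˡ (x ∷ y ∷ p) q (2∣y , h) = 2∣y , EvenIndexedEven-++⁻ˡ p q h

  OddIndexedEven-++⁻ˡ : ∀ p q → OddIndexedEven (p ++ q) → OddIndexedEven p
  OddIndexedEven-++⁻ˡ []      q h          = tt
  OddIndexedEven-++⁻ˡ (x ∷ p) q (2∣x , h) = 2∣x , EvenIndexedEven-++⁻ˡ p q h

  zeros : ℕ → List ℕ
  zeros k = replicate k 0

  EvenIndexedEven-zeros : ∀ k → EvenIndexedEven (zeros k)
  OddIndexedEven-zeros : ∀ k → OddIndexedEven (zeros k)
  EvenIndexedEven-zeros zero    = tt
  EvenIndexedEven-zeros (suc k) = OddIndexedEven⇒EvenIndexedEven 0 (zeros k) (OddIndexedEven-zeros k)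
  OddIndexedEven-zeros zero    = tt
  OddIndexedEven-zeros (suc k) = divides 0 ≡.refl , EvenIndexedEven-zeros k

  EvenIndexedEven-++-zeros : ∀ l k → EvenIndexedEven l → EvenIndexedEven (l ++ zeros k)
  EvenIndexedEven-++-zeros []          k h          = EvenIndexedEven-zeros k
  EvenIndexedEven-++-zeros (x ∷ [])    k h          =
    OddIndexedEven⇒EvenIndexedEven x (zeros k) (OddIndexedEven-zeros k)
  EvenIndexedEven-++-zeros (x ∷ y ∷ l) k (2∣y , h) = 2∣y , EvenIndexedEven-++-zeros l k h

  OddIndexedEven-++-zeros : ∀ l k → OddIndexedEven l → OddIndexedEven (l ++ zeros k)
  OddIndexedEven-++-zeros []      k h          = OddIndexedEven-zeros k
  OddIndexedEven-++-zeros (x ∷ l) k (2∣x , h) = 2∣x , EvenIndexedEven-++-zeros l k h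

  decreasing-++-zeros : ∀ l k → Decreasing l → Decreasing (l ++ zeros k)
  decreasing-++-zeros []          zero          ds         = []
  decreasing-++-zeros []          (suc zero)    ds         = [ 0 ]
  decreasing-++-zeros []          (suc (suc k)) ds         = z≤n ∷ decreasing-++-zeros [] (suc k) ds
  decreasing-++-zeros (x ∷ [])    zero          ds         = [ x ]
  decreasing-++-zeros (x ∷ [])    (suc k)       ds         = z≤n ∷ decreasing-++-zeros [] (suc k) []
  decreasing-++-zeros (x ∷ y ∷ l) k            (y≤x ∷ ds) = y≤x ∷ decreasing-++-zeros (y ∷ l) k ds

  oddParts-++-zeros : ∀ l k → oddParts (l ++ zeros k) ≡ oddParts l
  oddParts-++-zeros []      zero    = ≡.refl
  oddParts-++-zeros []      (suc k) = oddParts-++-zeros [] k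
  oddParts-++-zeros (x ∷ l) k       = ≡.cong (x % 2 +ℕ_) (oddParts-++-zeros l k)

  size-++-zeros : ∀ l k → size (l ++ zeros k) ≡ size l
  size-++-zeros []      zero    = ≡.refl
  size-++-zeros []      (suc k) = size-++-zeros [] k
  size-++-zeros (x ∷ l) k       = ≡.cong (x +ℕ_) (size-++-zeros l k)

  altSum-++-zeros : ∀ l k → altSum (l ++ zeros k) ≡ altSum l
  altSum-++-zeros []      zero    = ≡.refl
  altSum-++-zeros []      (suc k) = ≡.cong (λ z → + 0 - z) (altSum-++-zeros [] k)
  altSum-++-zeros (x ∷ l) k       = ≡.cong (λ z → + x - z) (altSum-++-zeros l k)

  positivePrefix : List ℕ → List ℕ
  positivePrefix []          = []
  positivePrefix (zero ∷ r)  = []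
  positivePrefix (suc x ∷ r) = suc x ∷ positivePrefix r

  positivePrefix-positive : ∀ l → All (0 <_) (positivePrefix l)
  positivePrefix-positive []          = []
  positivePrefix-positive (zero ∷ r)  = []
  positivePrefix-positive (suc x ∷ r) = s≤s z≤n ∷ positivePrefix-positive r

  positivePrefix-++-zeros : ∀ l k → All (0 <_) l → positivePrefix (l ++ zeros k) ≡ l
  positivePrefix-++-zeros []          zero    _         = ≡.refl
  positivePrefix-++-zeros []          (suc k) _         = ≡.refl
  positivePrefix-++-zeros (suc x ∷ l) k       (_ ∷ pos) = ≡.cong (suc x ∷_) (positivePrefix-++-zeros l k pos)

  decreasing⇒positivePrefix-++-zeros : ∀ l → Decreasing l →
    l ≡ positivePrefix l ++ zeros (length l ∸ length (positivePrefix l))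
  decreasing⇒positivePrefix-++-zeros []          _  = ≡.refl
  decreasing⇒positivePrefix-++-zeros (zero ∷ r)  ds = ≡.cong (0 ∷_) (zeros-after-zero r ds)
    where
    zeros-after-zero : ∀ r → Decreasing (0 ∷ r) → r ≡ zeros (length r)
    zeros-after-zero []         _          = ≡.refl
    zeros-after-zero (zero ∷ r) (z≤n ∷ ds) = ≡.cong (0 ∷_) (zeros-after-zero r ds)
  decreasing⇒positivePrefix-++-zeros (suc x ∷ r) ds =
    ≡.cong (suc x ∷_) (decreasing⇒positivePrefix-++-zeros r (decreasing-tail ds))

  length≤size : ∀ l → All (0 <_) l → length l ≤ size l
  length≤size []      []          = z≤n
  length≤size (x ∷ l) (0<x ∷ pos) = ℕ.+-mono-≤ 0<x (length≤size l pos)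

module PaddedPartitions where

  open Counting
  open Parity
  open PartitionLists
  open import Data.Bool using (Bool)
  open import Data.Integer using (+_; _+_; -_; _-_; 1ℤ)
  import Data.Integer.Properties as ℤ
  open import Data.List using (List; []; _∷_; _++_; map; length)
  import Data.List.Properties as List
  open import Data.List.Relation.Unary.All using (All; []; _∷_)
  open import Data.Nat.Divisibility using (_∣_)
  open import Data.Unit using (⊤; tt)

  Block : Set
  Block = (Bool × ℕ) × ℕ

  blockWeight : ℕ → ℕ → Block → Weight
  blockWeight d K ((ε , s) , r) = (bit ε , bit ε , bit ε *ℕ (d +ℕ 4 *ℕ K))
    +ʷ (s *ℕ 0 , s *ℕ 2 , s *ℕ (2 +ℕ 4 *ℕ K)) +ʷ (r *ℕ 0 , r *ℕ 0 , r *ℕ (4 +ℕ 4 *ℕ K))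

  blockSeries : ℕ → ℕ → FPS
  blockSeries d K = (one ⊖ mono (- 1ℤ) 1 1 (d +ℕ 4 *ℕ K)) ⊗ inv1m (mono 1ℤ 0 2 (2 +ℕ 4 *ℕ K))
                    ⊗ inv1m (mono 1ℤ 0 0 (4 +ℕ 4 *ℕ K))

  GenFun-block : ∀ d K → GenFun (λ _ → (⊤ × ⊤) × ⊤) (blockWeight d K) (blockSeries d K)
  GenFun-block d K = GenFun-× (GenFun-× (GenFun-Bool (d +ℕ 4 *ℕ K)) (GenFun-ℕ 0 2 (2 +ℕ 4 *ℕ K) (s≤s z≤n)))
                              (GenFun-ℕ 0 0 (4 +ℕ 4 *ℕ K) (s≤s z≤n))

  shift : Block → ℕ
  shift ((ε , s) , r) = 2 *ℕ (s +ℕ r +ℕ bit ε)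

  2∣shift : ∀ x → 2 ∣ shift x
  2∣shift ((ε , s) , r) = 2∣2* (s +ℕ r +ℕ bit ε)

  -- A padded list of length 2K + 2 in class Par ends with (first x , second x) for a block x, and
  -- its other parts exceed those of a padded list of length 2K by shift x.
  record PairCoding (Par : List ℕ → Set) (d : ℕ) : Set₁ where
    field
      LastPair      : ℕ → ℕ → Set
      nil           : Par []
      join          : ∀ K p b c → length p ≡ double K → Par p → LastPair b c → Par (p ++ b ∷ c ∷ [])
      split         : ∀ K p b c → length p ≡ double K → Par (p ++ b ∷ c ∷ []) → Par p × LastPair b c
      map-+         : ∀ t p → 2 ∣ t → Par p → Par (map (t +ℕ_) p)
      map-∸         : ∀ t p → 2 ∣ t → Par p → Par (map (_∸ t) p)
      first second  : Block → ℕ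
      decode        : ℕ → ℕ → Block
      encode-valid  : ∀ x → LastPair (first x) (second x) × second x ≤ first x × first x ≤ shift x
      decode-encode : ∀ x → decode (first x) (second x) ≡ x
      encode-decode : ∀ b c → LastPair b c → c ≤ b → first (decode b c) ≡ b × second (decode b c) ≡ c
      shift-bound   : ∀ K p b c → length p ≡ double K → Decreasing (p ++ b ∷ c ∷ []) → Par (p ++ b ∷ c ∷ []) →
                      All (shift (decode b c) ≤_) p
      weight        : ∀ K x → (oddParts (first x ∷ second x ∷ []) , first x ∸ second x ,
                               double K *ℕ shift x +ℕ size (first x ∷ second x ∷ [])) ≡ blockWeight d K x

  module PaddedGenFun {Par : List ℕ → Set} {d : ℕ} (coding : PairCoding Par d) where

    open PairCoding coding

    Padded : ℕ → List ℕ → Set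
    Padded K l = length l ≡ double K × Decreasing l × Par l

    paddedWeight : List ℕ → Weight
    paddedWeight l = (oddParts l , altSumℕ l , size l)

    attach : List ℕ × Block → List ℕ
    attach (μ , x) = map (shift x +ℕ_) μ ++ first x ∷ second x ∷ []

    detach : List ℕ → List ℕ × Block
    detach l = let (p , b , c) = splitLastPair l in map (_∸ shift (decode b c)) p , decode b c

    attach-Padded : ∀ K μ x → Padded K μ → Padded (suc K) (attach (μ , x))
    attach-Padded K μ x (len≡ , dμ , pμ) with encode-valid x
    ... | lastPair , c≤b , b≤t =
      length-++-pair (map (shift x +ℕ_) μ) (first x) (second x) len≡′ ,
      decreasing-++⁺ (map (shift x +ℕ_) μ) (decreasing-map-+ (shift x) dμ) (≤-map-+ μ b≤t) (c≤b ∷ [ second x ]) ,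
      join K (map (shift x +ℕ_) μ) (first x) (second x) len≡′ (map-+ (shift x) μ (2∣shift x) pμ) lastPair
      where
      len≡′ = ≡.trans (List.length-map (shift x +ℕ_) μ) len≡

    detach-Padded : ∀ K l → Padded (suc K) l → Padded K (proj₁ (detach l))
    detach-Padded K l (len≡ , dl , pl) with lastPairView K l len≡
    ... | (p ++[ b , c ]) len≡′ rewrite splitLastPair-++ p b c with split K p b c len≡′ pl
    ... | pp , _ =
      ≡.trans (List.length-map _ p) len≡′ ,
      decreasing-map-∸ (shift (decode b c)) (decreasing-++⁻ˡ p _ dl) ,
      map-∸ (shift (decode b c)) p (2∣shift (decode b c)) pp

    attach∘detach : ∀ K l → Padded (suc K) l → attach (detach l) ≡ l
    attach∘detach K l (len≡ , dl , pl) with lastPairView K l len≡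
    ... | (p ++[ b , c ]) len≡′ rewrite splitLastPair-++ p b c with split K p b c len≡′ pl
    ... | _ , lastPair with encode-decode b c lastPair (decreasing-++-pair⇒≤ p dl)
    ... | first≡ , second≡ rewrite first≡ | second≡ =
      ≡.cong (_++ b ∷ c ∷ []) (map-+-∸ (shift (decode b c)) p (shift-bound K p b c len≡′ dl pl))

    detach∘attach : ∀ μ x → detach (attach (μ , x)) ≡ (μ , x)
    detach∘attach μ x rewrite splitLastPair-++ (map (shift x +ℕ_) μ) (first x) (second x) | decode-encode x =
      ≡.cong (_, x) (map-∸-+ (shift x) μ)

    attach-weight : ∀ K μ x → Padded K μ → paddedWeight (attach (μ , x)) ≡ paddedWeight μ +ʷ blockWeight d K x
    attach-weight K μ x pμ@(len≡ , dμ , _) =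
      ≡.trans (≡.cong₂ _,_ oddParts≡ (≡.cong₂ _,_ altSumℕ≡ size≡)) (≡.cong (paddedWeight μ +ʷ_) (weight K x))
      where
      t = shift x
      b = first x
      c = second x
      len≡′ = ≡.trans (List.length-map (t +ℕ_) μ) len≡

      oddParts≡ : oddParts (attach (μ , x)) ≡ oddParts μ +ℕ oddParts (b ∷ c ∷ [])
      oddParts≡ = ≡.trans (oddParts-++ (map (t +ℕ_) μ) (b ∷ c ∷ []))
                          (≡.cong (_+ℕ oddParts (b ∷ c ∷ [])) (oddParts-map-+ t μ (2∣shift x)))

      altSumℕ≡ : altSumℕ (attach (μ , x)) ≡ altSumℕ μ +ℕ (b ∸ c)
      altSumℕ≡ = ℤ.+-injective (begin
        + altSumℕ (attach (μ , x))                         ≡⟨ altSum≡altSumℕ (proj₁ (proj₂ (attach-Padded K μ x pμ))) ⟨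
        altSum (map (t +ℕ_) μ ++ b ∷ c ∷ [])              ≡⟨ altSum-++ K (map (t +ℕ_) μ) (b ∷ c ∷ []) len≡′ ⟩
        altSum (map (t +ℕ_) μ) + altSum (b ∷ c ∷ [])
          ≡⟨ ≡.cong₂ _+_ (≡.trans (altSum-map-+ K t μ len≡) (altSum≡altSumℕ dμ))
                         (altSum≡altSumℕ (proj₁ (proj₂ (encode-valid x)) ∷ [ c ])) ⟩
        + altSumℕ μ + + (b ∸ c)                            ∎)
        where open ≡.≡-Reasoning

      size≡ : size (attach (μ , x)) ≡ size μ +ℕ (double K *ℕ t +ℕ size (b ∷ c ∷ []))
      size≡ = begin
        size (map (t +ℕ_) μ ++ b ∷ c ∷ [])                   ≡⟨ size-++ (map (t +ℕ_) μ) (b ∷ c ∷ []) ⟩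
        size (map (t +ℕ_) μ) +ℕ size (b ∷ c ∷ [])            ≡⟨ ≡.cong (_+ℕ size (b ∷ c ∷ [])) (size-map-+ t μ) ⟩
        length μ *ℕ t +ℕ size μ +ℕ size (b ∷ c ∷ [])
          ≡⟨ ≡.cong (λ n → n *ℕ t +ℕ size μ +ℕ size (b ∷ c ∷ [])) len≡ ⟩
        double K *ℕ t +ℕ size μ +ℕ size (b ∷ c ∷ [])
          ≡⟨ ≡.cong (_+ℕ size (b ∷ c ∷ [])) (ℕ.+-comm (double K *ℕ t) (size μ)) ⟩
        size μ +ℕ double K *ℕ t +ℕ size (b ∷ c ∷ [])         ≡⟨ ℕ.+-assoc (size μ) (double K *ℕ t) (size (b ∷ c ∷ [])) ⟩
        size μ +ℕ (double K *ℕ t +ℕ size (b ∷ c ∷ []))       ∎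
        where open ≡.≡-Reasoning

    GenFun-Padded : ∀ K → GenFun (Padded K) paddedWeight (prodFin (blockSeries d) K)
    GenFun-Padded zero = GenFun-transport {PB = λ _ → ⊤} {wB = λ _ → (0 , 0 , 0)} (λ _ → tt) (λ _ → [])
      (λ _ _ → tt) (λ _ _ → ≡.refl , [] , nil) (λ _ _ → ≡.refl) (λ { [] _ → ≡.refl }) (λ _ _ → ≡.refl)
      (GenFun-unit 0 0 0)
    GenFun-Padded (suc K) = GenFun-transport detach attach
      (λ l pl → detach-Padded K l pl , (tt , tt) , tt)
      (λ (μ , x) (pμ , _) → attach-Padded K μ x pμ)
      (λ (μ , x) (pμ , _) → attach-weight K μ x pμ)
      (λ l pl → attach∘detach K l pl)
      (λ (μ , x) _ → detach∘attach μ x)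
      (GenFun-× (GenFun-Padded K) (GenFun-block d K))

module EvenIndexedEvenCoding where

  open Parity
  open PartitionLists
  open PaddedPartitions using (Block; shift; PairCoding)
  open import Data.Bool using (true; false)
  open import Data.List using (List; []; _∷_; _++_; length)
  open import Data.List.Relation.Unary.All using (All; []; _∷_)
  open import Data.Nat using (⌊_/2⌋; _%_)
  open import Data.Nat.Divisibility using (_∣_; ∣m∣n⇒∣m+n)
  open import Data.Nat.Solver using (module +-*-Solver)
  open import Data.Unit using (tt)
  open +-*-Solver using (solve; _:=_; _:+_; _:*_; con)

  join : ∀ K p b c → length p ≡ double K → EvenIndexedEven p → 2 ∣ c → EvenIndexedEven (p ++ b ∷ c ∷ [])
  join zero    []          b c _    _          2∣c = 2∣c , tt
  join (suc K) (x ∷ y ∷ p) b c len≡ (2∣y , h) 2∣c = 2∣y , join K p b c (suc-injective² len≡) h 2∣c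

  split : ∀ K p b c → length p ≡ double K → EvenIndexedEven (p ++ b ∷ c ∷ []) → EvenIndexedEven p × 2 ∣ c
  split zero    []          b c _    (2∣c , _) = tt , 2∣c
  split (suc K) (x ∷ y ∷ p) b c len≡ (2∣y , h) =
    Product.map₁ (2∣y ,_) (split K p b c (suc-injective² len≡) h)

  first second : Block → ℕ
  first  ((ε , s) , r) = 2 *ℕ (s +ℕ r) +ℕ bit ε
  second ((ε , s) , r) = 2 *ℕ r

  decode : ℕ → ℕ → Block
  decode b c = ((parity b , ⌊ b /2⌋ ∸ ⌊ c /2⌋) , ⌊ c /2⌋)

  encode-valid : ∀ x → 2 ∣ second x × second x ≤ first x × first x ≤ shift x
  encode-valid ((ε , s) , r) =
    2∣2* r ,
    ℕ.≤-trans (ℕ.*-monoʳ-≤ 2 (ℕ.m≤n+m r s)) (ℕ.m≤m+n _ (bit ε)) ,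
    ≡.subst (2 *ℕ (s +ℕ r) +ℕ bit ε ≤_) (≡.sym (2[x+ε]≡[2x+ε]+ε (s +ℕ r) ε)) (ℕ.m≤m+n _ (bit ε))

  decode-encode : ∀ x → decode (first x) (second x) ≡ x
  decode-encode ((ε , s) , r) = ≡.cong₂ _,_
    (≡.cong₂ _,_ (parity-2x+ε (s +ℕ r) ε)
                 (≡.trans (≡.cong₂ _∸_ (⌊2x+ε/2⌋ (s +ℕ r) ε) (⌊2x/2⌋ r)) (ℕ.m+n∸n≡m s r)))
    (⌊2x/2⌋ r)

  first-decode : ∀ b c → c ≤ b → first (decode b c) ≡ b
  first-decode b c c≤b = ≡.trans (≡.cong (λ h → 2 *ℕ h +ℕ bit (parity b)) (ℕ.m∸n+n≡m (ℕ.⌊n/2⌋-mono c≤b)))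
                                 (2⌊n/2⌋+parity b)

  encode-decode : ∀ b c → 2 ∣ c → c ≤ b → first (decode b c) ≡ b × second (decode b c) ≡ c
  encode-decode b c 2∣c c≤b = first-decode b c c≤b , 2⌊n/2⌋≡n 2∣c

  shift-decode : ∀ b c → c ≤ b → shift (decode b c) ≡ b +ℕ bit (parity b)
  shift-decode b c c≤b = ≡.trans (2[x+ε]≡[2x+ε]+ε (⌊ b /2⌋ ∸ ⌊ c /2⌋ +ℕ ⌊ c /2⌋) (parity b))
                                 (≡.cong (_+ℕ bit (parity b)) (first-decode b c c≤b))

  roundUp≤even : ∀ b y → 2 ∣ y → b ≤ y → b +ℕ bit (parity b) ≤ y
  roundUp≤even b y 2∣y b≤y with parity b in parity≡
  ... | false = ≡.subst (_≤ y) (≡.sym (ℕ.+-identityʳ b)) b≤y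
  ... | true with ℕ.m≤n⇒m<n∨m≡n b≤y
  ...   | inj₁ b<y    = ≡.subst (_≤ y) (ℕ.+-comm 1 b) b<y
  ...   | inj₂ ≡.refl with ≡.trans (≡.sym parity≡) (even⇒parity≡false 2∣y)
  ...     | ()

  roundUp-bound : ∀ K p b c → length p ≡ double K → Decreasing (p ++ b ∷ c ∷ []) →
    EvenIndexedEven (p ++ b ∷ c ∷ []) → All (b +ℕ bit (parity b) ≤_) p
  roundUp-bound zero    []          b c _    _  _          = []
  roundUp-bound (suc K) (x ∷ y ∷ p) b c len≡ ds (2∣y , h) with decreasing-++⇒≤ (x ∷ y ∷ p) ds | ds
  ... | _ ∷ b≤y ∷ _ | y≤x ∷ ds′ =
    ℕ.≤-trans (roundUp≤even b y 2∣y b≤y) y≤x ∷ roundUp≤even b y 2∣y b≤y ∷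
    roundUp-bound K p b c (suc-injective² len≡) (decreasing-tail ds′) h

  shift-bound : ∀ K p b c → length p ≡ double K → Decreasing (p ++ b ∷ c ∷ []) →
    EvenIndexedEven (p ++ b ∷ c ∷ []) → All (shift (decode b c) ≤_) p
  shift-bound K p b c len≡ ds h =
    ≡.subst (λ t → All (t ≤_) p) (≡.sym (shift-decode b c (decreasing-++-pair⇒≤ p ds)))
            (roundUp-bound K p b c len≡ ds h)

  weight : ∀ K x → (oddParts (first x ∷ second x ∷ []) , first x ∸ second x ,
                    double K *ℕ shift x +ℕ size (first x ∷ second x ∷ [])) ≡ PaddedPartitions.blockWeight 1 K x
  weight K ((ε , s) , r) = ≡.cong₂ _,_ oddParts≡ (≡.cong₂ _,_ difference≡ size≡)
    where
    e = bit ε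
    oddParts≡ : (2 *ℕ (s +ℕ r) +ℕ e) % 2 +ℕ ((2 *ℕ r) % 2 +ℕ 0) ≡ e +ℕ s *ℕ 0 +ℕ r *ℕ 0
    oddParts≡ = ≡.trans (≡.cong₂ _+ℕ_ ([2x+ε]%2 (s +ℕ r) ε) (≡.cong (_+ℕ 0) ([2x]%2 r)))
                        (solve 3 (λ e s r → e :+ (con 0 :+ con 0) := e :+ s :* con 0 :+ r :* con 0) ≡.refl e s r)
    difference≡ : 2 *ℕ (s +ℕ r) +ℕ e ∸ 2 *ℕ r ≡ e +ℕ s *ℕ 2 +ℕ r *ℕ 0
    difference≡ = ≡.trans (≡.cong (_∸ 2 *ℕ r)
                    (solve 3 (λ s r e → con 2 :* (s :+ r) :+ e := con 2 :* r :+ (con 2 :* s :+ e)) ≡.refl s r e))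
                  (≡.trans (ℕ.m+n∸m≡n (2 *ℕ r) (2 *ℕ s +ℕ e))
                           (solve 3 (λ s r e → con 2 :* s :+ e := e :+ s :* con 2 :+ r :* con 0) ≡.refl s r e))
    size≡ : double K *ℕ (2 *ℕ (s +ℕ r +ℕ e)) +ℕ (2 *ℕ (s +ℕ r) +ℕ e +ℕ (2 *ℕ r +ℕ 0))
            ≡ e *ℕ (1 +ℕ 4 *ℕ K) +ℕ s *ℕ (2 +ℕ 4 *ℕ K) +ℕ r *ℕ (4 +ℕ 4 *ℕ K)
    size≡ rewrite double≡2* K =
      solve 4 (λ K s r e → con 2 :* K :* (con 2 :* (s :+ r :+ e)) :+ (con 2 :* (s :+ r) :+ e :+ (con 2 :* r :+ con 0))
                           := e :* (con 1 :+ con 4 :* K) :+ s :* (con 2 :+ con 4 :* K) :+ r :* (con 4 :+ con 4 :* K))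
              ≡.refl K s r e

  evenIndexedEvenCoding : PairCoding EvenIndexedEven 1
  evenIndexedEvenCoding = record
    { LastPair      = λ _ c → 2 ∣ c
    ; nil           = tt
    ; join          = join
    ; split         = split
    ; map-+         = λ t p 2∣t → EvenIndexedEven-map (t +ℕ_) (∣m∣n⇒∣m+n 2∣t) p
    ; map-∸         = λ t p 2∣t → EvenIndexedEven-map (_∸ t) (2∣∸ 2∣t) p
    ; first         = first
    ; second        = second
    ; decode        = decode
    ; encode-valid  = encode-valid
    ; decode-encode = decode-encode
    ; encode-decode = encode-decode
    ; shift-bound   = shift-bound
    ; weight        = weight
    }

module OddIndexedEvenCoding where

  open Parity
  open PartitionLists
  open PaddedPartitions using (Block; shift; PairCoding)
  open import Data.List using (List; []; _∷_; _++_; length)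
  open import Data.List.Relation.Unary.All using (All)
  open import Data.Nat using (⌊_/2⌋; _%_)
  open import Data.Nat.Divisibility using (_∣_; ∣m∣n⇒∣m+n)
  open import Data.Nat.Solver using (module +-*-Solver)
  open import Data.Unit using (tt)
  open +-*-Solver using (solve; _:=_; _:+_; _:*_; con)

  join : ∀ K p b c → length p ≡ double K → OddIndexedEven p → 2 ∣ b → OddIndexedEven (p ++ b ∷ c ∷ [])
  join zero    []          b c _    _          2∣b = 2∣b , tt
  join (suc K) (x ∷ y ∷ p) b c len≡ (2∣x , h) 2∣b = 2∣x , OddIndexedEven⇒EvenIndexedEven y (p ++ b ∷ c ∷ [])
    (join K p b c (suc-injective² len≡) (EvenIndexedEven⇒OddIndexedEven y p h) 2∣b)

  split : ∀ K p b c → length p ≡ double K → OddIndexedEven (p ++ b ∷ c ∷ []) → OddIndexedEven p × 2 ∣ b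
  split zero    []          b c _    (2∣b , _) = tt , 2∣b
  split (suc K) (x ∷ y ∷ p) b c len≡ (2∣x , h) =
    Product.map₁ (λ hp → 2∣x , OddIndexedEven⇒EvenIndexedEven y p hp)
      (split K p b c (suc-injective² len≡) (EvenIndexedEven⇒OddIndexedEven y (p ++ b ∷ c ∷ []) h))

  first second : Block → ℕ
  first  ((ε , s) , r) = 2 *ℕ (s +ℕ r +ℕ bit ε)
  second ((ε , s) , r) = 2 *ℕ r +ℕ bit ε

  decode : ℕ → ℕ → Block
  decode b c = ((parity c , ⌊ b /2⌋ ∸ ⌊ c /2⌋ ∸ bit (parity c)) , ⌊ c /2⌋)

  first≡second+2s+ε : ∀ s r e → 2 *ℕ (s +ℕ r +ℕ e) ≡ (2 *ℕ r +ℕ e) +ℕ (2 *ℕ s +ℕ e)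
  first≡second+2s+ε = solve 3 (λ s r e → con 2 :* (s :+ r :+ e) := (con 2 :* r :+ e) :+ (con 2 :* s :+ e)) ≡.refl

  encode-valid : ∀ x → 2 ∣ first x × second x ≤ first x × first x ≤ shift x
  encode-valid ((ε , s) , r) =
    2∣2* (s +ℕ r +ℕ bit ε) ,
    ≡.subst (2 *ℕ r +ℕ bit ε ≤_) (≡.sym (first≡second+2s+ε s r (bit ε))) (ℕ.m≤m+n _ _) ,
    ≤-refl

  decode-encode : ∀ x → decode (first x) (second x) ≡ x
  decode-encode ((ε , s) , r) = ≡.cong₂ _,_ (≡.cong₂ _,_ (parity-2x+ε r ε) s≡) (⌊2x+ε/2⌋ r ε)
    where
    s≡ : ⌊ 2 *ℕ (s +ℕ r +ℕ bit ε) /2⌋ ∸ ⌊ 2 *ℕ r +ℕ bit ε /2⌋ ∸ bit (parity (2 *ℕ r +ℕ bit ε)) ≡ s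
    s≡ = begin
      ⌊ 2 *ℕ (s +ℕ r +ℕ bit ε) /2⌋ ∸ ⌊ 2 *ℕ r +ℕ bit ε /2⌋ ∸ bit (parity (2 *ℕ r +ℕ bit ε))
        ≡⟨ ≡.cong₂ _∸_ (≡.cong₂ _∸_ (⌊2x/2⌋ (s +ℕ r +ℕ bit ε)) (⌊2x+ε/2⌋ r ε)) (≡.cong bit (parity-2x+ε r ε)) ⟩
      s +ℕ r +ℕ bit ε ∸ r ∸ bit ε
        ≡⟨ ≡.cong (λ n → n ∸ r ∸ bit ε) (solve 3 (λ s r e → s :+ r :+ e := s :+ e :+ r) ≡.refl s r (bit ε)) ⟩
      s +ℕ bit ε +ℕ r ∸ r ∸ bit ε
        ≡⟨ ≡.cong (_∸ bit ε) (ℕ.m+n∸n≡m (s +ℕ bit ε) r) ⟩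
      s +ℕ bit ε ∸ bit ε
        ≡⟨ ℕ.m+n∸n≡m s (bit ε) ⟩
      s ∎
      where open ≡.≡-Reasoning

  first-decode : ∀ b c → 2 ∣ b → c ≤ b → first (decode b c) ≡ b
  first-decode b c 2∣b c≤b = ≡.trans (≡.cong (2 *ℕ_) h≡) (2⌊n/2⌋≡n 2∣b)
    where
    h = ⌊ b /2⌋
    hc = ⌊ c /2⌋
    e = bit (parity c)
    hc+e≤h : hc +ℕ e ≤ h
    hc+e≤h = 2x+ε≤2y⇒x+ε≤y hc h (parity c) (≡.subst₂ _≤_ (≡.sym (2⌊n/2⌋+parity c)) (≡.sym (2⌊n/2⌋≡n 2∣b)) c≤b)
    h≡ : h ∸ hc ∸ e +ℕ hc +ℕ e ≡ h
    h≡ = ≡.trans (ℕ.+-assoc (h ∸ hc ∸ e) hc e)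
           (≡.trans (≡.cong (_+ℕ (hc +ℕ e)) (ℕ.∸-+-assoc h hc e)) (ℕ.m∸n+n≡m hc+e≤h))

  encode-decode : ∀ b c → 2 ∣ b → c ≤ b → first (decode b c) ≡ b × second (decode b c) ≡ c
  encode-decode b c 2∣b c≤b = first-decode b c 2∣b c≤b , 2⌊n/2⌋+parity c

  -- Here shift and first coincide, so the parts are lowered by b itself.
  shift-bound : ∀ K p b c → length p ≡ double K → Decreasing (p ++ b ∷ c ∷ []) →
    OddIndexedEven (p ++ b ∷ c ∷ []) → All (shift (decode b c) ≤_) p
  shift-bound K p b c len≡ ds h =
    ≡.subst (λ t → All (t ≤_) p)
            (≡.sym (first-decode b c (proj₂ (split K p b c len≡ h)) (decreasing-++-pair⇒≤ p ds)))
            (decreasing-++⇒≤ p ds)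

  weight : ∀ K x → (oddParts (first x ∷ second x ∷ []) , first x ∸ second x ,
                    double K *ℕ shift x +ℕ size (first x ∷ second x ∷ [])) ≡ PaddedPartitions.blockWeight 3 K x
  weight K ((ε , s) , r) = ≡.cong₂ _,_ oddParts≡ (≡.cong₂ _,_ difference≡ size≡)
    where
    e = bit ε
    oddParts≡ : (2 *ℕ (s +ℕ r +ℕ e)) % 2 +ℕ ((2 *ℕ r +ℕ e) % 2 +ℕ 0) ≡ e +ℕ s *ℕ 0 +ℕ r *ℕ 0
    oddParts≡ = ≡.trans (≡.cong₂ _+ℕ_ ([2x]%2 (s +ℕ r +ℕ e)) (≡.cong (_+ℕ 0) ([2x+ε]%2 r ε)))
                        (solve 3 (λ e s r → con 0 :+ (e :+ con 0) := e :+ s :* con 0 :+ r :* con 0) ≡.refl e s r)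
    difference≡ : 2 *ℕ (s +ℕ r +ℕ e) ∸ (2 *ℕ r +ℕ e) ≡ e +ℕ s *ℕ 2 +ℕ r *ℕ 0
    difference≡ = ≡.trans (≡.cong (_∸ (2 *ℕ r +ℕ e)) (first≡second+2s+ε s r e))
                  (≡.trans (ℕ.m+n∸m≡n (2 *ℕ r +ℕ e) (2 *ℕ s +ℕ e))
                           (solve 3 (λ s r e → con 2 :* s :+ e := e :+ s :* con 2 :+ r :* con 0) ≡.refl s r e))
    size≡ : double K *ℕ (2 *ℕ (s +ℕ r +ℕ e)) +ℕ (2 *ℕ (s +ℕ r +ℕ e) +ℕ (2 *ℕ r +ℕ e +ℕ 0))
            ≡ e *ℕ (3 +ℕ 4 *ℕ K) +ℕ s *ℕ (2 +ℕ 4 *ℕ K) +ℕ r *ℕ (4 +ℕ 4 *ℕ K)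
    size≡ rewrite double≡2* K =
      solve 4 (λ K s r e → con 2 :* K :* (con 2 :* (s :+ r :+ e)) :+ (con 2 :* (s :+ r :+ e) :+ (con 2 :* r :+ e :+ con 0))
                           := e :* (con 3 :+ con 4 :* K) :+ s :* (con 2 :+ con 4 :* K) :+ r :* (con 4 :+ con 4 :* K))
              ≡.refl K s r e

  oddIndexedEvenCoding : PairCoding OddIndexedEven 3
  oddIndexedEvenCoding = record
    { LastPair      = λ b _ → 2 ∣ b
    ; nil           = tt
    ; join          = join
    ; split         = split
    ; map-+         = λ t p 2∣t → OddIndexedEven-map (t +ℕ_) (∣m∣n⇒∣m+n 2∣t) p
    ; map-∸         = λ t p 2∣t → OddIndexedEven-map (_∸ t) (2∣∸ 2∣t) p
    ; first         = first
    ; second        = second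
    ; decode        = decode
    ; encode-valid  = encode-valid
    ; decode-encode = decode-encode
    ; encode-decode = encode-decode
    ; shift-bound   = shift-bound
    ; weight        = weight
    }

open import Data.List using (List; _++_)
open PartitionLists using (zeros)
open PaddedPartitions using (PairCoding)

module PartitionsFromPadded
  {Par : List ℕ → Set} {d : ℕ} (coding : PairCoding Par d)
  (Par-++-zeros : ∀ l k → Par l → Par (l ++ zeros k))
  (Par-++⁻ˡ : ∀ p q → Par (p ++ q) → Par p) where

  open Counting using (HasCount; HasCount-transport)
  open PartitionLists
  open PaddedPartitions using (blockSeries)
  open PaddedPartitions.PaddedGenFun coding
  open import Data.Integer using (+_)
  import Data.Integer.Properties as ℤ
  open import Data.List using (length)
  import Data.List.Properties as List

  module _ (i j N : ℕ) where

    PartitionQ PaddedQ : List ℕ → Set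
    PartitionQ λs = (IsPartition λs × Par λs) × oddParts λs ≡ i × altSum λs ≡ + j × size λs ≡ N
    PaddedQ l     = Padded N l × paddedWeight l ≡ (i , j , N)

    pad : List ℕ → List ℕ
    pad λs = λs ++ zeros (double N ∸ length λs)

    pad-PaddedQ : ∀ λs → PartitionQ λs → PaddedQ (pad λs)
    pad-PaddedQ λs (((pos , dλ) , pλ) , odd≡ , alt≡ , size≡) =
      (≡.trans (List.length-++ λs) (≡.trans (≡.cong (length λs +ℕ_) (List.length-replicate (double N ∸ length λs)))
                                            (ℕ.m+[n∸m]≡n length≤double)) ,
       decreasing-++-zeros λs _ dλ , Par-++-zeros λs _ pλ) ,
      ≡.cong₂ _,_ (≡.trans (oddParts-++-zeros λs _) odd≡)
        (≡.cong₂ _,_ (ℤ.+-injective (≡.trans (≡.sym (altSum≡altSumℕ (decreasing-++-zeros λs _ dλ)))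
                                              (≡.trans (altSum-++-zeros λs _) alt≡)))
                     (≡.trans (size-++-zeros λs _) size≡))
      where
      length≤double : length λs ≤ double N
      length≤double = ℕ.≤-trans (length≤size λs pos) (≡.subst (_≤ double N) (≡.sym size≡) (n≤double N))

    positivePrefix-PartitionQ : ∀ l → PaddedQ l → PartitionQ (positivePrefix l)
    positivePrefix-PartitionQ l ((_ , dl , pl) , w≡) =
      ((positivePrefix-positive l , decreasing-++⁻ˡ (positivePrefix l) _ (≡.subst Decreasing l≡ dl)) ,
       Par-++⁻ˡ (positivePrefix l) _ (≡.subst Par l≡ pl)) ,
      ≡.trans (≡.sym (≡.trans (≡.cong oddParts l≡) (oddParts-++-zeros (positivePrefix l) k))) (≡.cong proj₁ w≡) ,
      ≡.trans (≡.sym (≡.trans (≡.cong altSum l≡) (altSum-++-zeros (positivePrefix l) k)))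
              (≡.trans (altSum≡altSumℕ dl) (≡.cong (+_ ∘ proj₁ ∘ proj₂) w≡)) ,
      ≡.trans (≡.sym (≡.trans (≡.cong size l≡) (size-++-zeros (positivePrefix l) k))) (≡.cong (proj₂ ∘ proj₂) w≡)
      where
      k = length l ∸ length (positivePrefix l)
      l≡ : l ≡ positivePrefix l ++ zeros k
      l≡ = decreasing⇒positivePrefix-++-zeros l dl

    positivePrefix∘pad : ∀ λs → PartitionQ λs → positivePrefix (pad λs) ≡ λs
    positivePrefix∘pad λs (((pos , _) , _) , _) = positivePrefix-++-zeros λs _ pos

    pad∘positivePrefix : ∀ l → PaddedQ l → pad (positivePrefix l) ≡ l
    pad∘positivePrefix l ((len≡ , dl , _) , _) =
      ≡.trans (≡.cong (λ n → positivePrefix l ++ zeros (n ∸ length (positivePrefix l))) (≡.sym len≡))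
              (≡.sym (decreasing⇒positivePrefix-++-zeros l dl))

    padded⇒partition : ∀ c → HasCount PaddedQ c → HasCount PartitionQ c
    padded⇒partition c = HasCount-transport pad positivePrefix pad-PaddedQ positivePrefix-PartitionQ
                                            positivePrefix∘pad pad∘positivePrefix

  isGenFun : ∀ f → (∀ i j N → prodFin (blockSeries d) N i j N ≡ f i j N) → IsGenFun (λ λs → IsPartition λs × Par λs) f
  isGenFun f coeff≡ i j N = padded⇒partition i j N (f i j N)
    (≡.subst (HasCount _) (coeff≡ i j N) (GenFun-Padded N i j N))

mainTheorem11 : (IsGenFun InP1 sumSide1 × (∀ i j N → sumSide1 i j N ≡ prodSide1 i j N))
    × (IsGenFun InP2 sumSide2 × (∀ i j N → sumSide2 i j N ≡ prodSide2 i j N))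
mainTheorem11 =
  ( PartitionsFromPadded.isGenFun EvenIndexedEvenCoding.evenIndexedEvenCoding
      PartitionLists.EvenIndexedEven-++-zeros PartitionLists.EvenIndexedEven-++⁻ˡ
      sumSide1 (SumSide.blockProduct≡sumSide 3 1 ≡.refl (s≤s z≤n))
  , SumSide.sumSide≡productSide 3 1 ≡.refl (s≤s z≤n) )
  , ( PartitionsFromPadded.isGenFun OddIndexedEvenCoding.oddIndexedEvenCoding
      PartitionLists.OddIndexedEven-++-zeros PartitionLists.OddIndexedEven-++⁻ˡ
      sumSide2 (SumSide.blockProduct≡sumSide 1 3 ≡.refl (s≤s z≤n))
  , SumSide.sumSide≡productSide 1 3 ≡.refl (s≤s z≤n) )
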